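{- Let $\mathbb{A}=\mathbb{A}_\chi(\mathcal{M})$ be a $\chi$-algebra on a matroid $\mathcal{M}$ on $[n]$, let $I^\sigma$ be an ordered independent set of $\mathcal{M}$ with $|I|=\ell$, and let $J$ be an independent set of $\mathcal{M}$ with $|J|=\ell$. Then $\mathfrak{p}_{I^\sigma}(e_J)\ne0$ if and only if there is a unique permutation $\tau\in S_\ell$ such that $\mathbf{Flag}(J^\tau)=\mathbf{Flag}(I^\sigma)$, and in this case $\mathfrak{p}_{I^\sigma}(e_J)=\chi(I^\sigma)/\chi(J^\tau)$. In particular $\mathfrak{p}_{I^\sigma}(e_I)=1$ for every independent set $I$ and every permutation $\sigma$.
   Context: $\mathcal{M}$ is a matroid on $[n]=\{1,\dots,n\}$ with closure operator $\mathrm{cl}$, and $\mathbb{K}$ a field. $\mathcal{E}$ is the graded $\mathbb{K}$-algebra generated by $1,e_1,\dots,e_n$ subject to $e_i^2=0$ and $e_je_i=\beta_{i,j}e_ie_j$ ($i<j$, $\beta_{i,j}\in\mathbb{K}\setminus0$ fixed); $e_X=e_{i_1}\cdots e_{i_m}$ for $X=\{i_1<\dots<i_m\}$. An ordered set $X^\sigma=(i_{\sigma(1)},\dots,i_{\sigma(m)})$ lists $X$ (unordered sets are taken in increasing order), $*$ is concatenation, and $\chi:2^{[n]}\to\mathbb{K}$ is extended by $\chi(X^\sigma)=\mathrm{sgn}(\sigma)\chi(X)$. The $\chi$-boundary is $\partial e_X=\sum_{p=1}^m(-1)^p\chi(X\setminus i_p)e_{X\setminus i_p}$. A unidependent is a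 set containing exactly one circuit. $\Im_\chi(\mathcal{M})$ is the right ideal generated by $\partial e_C$ ($C$ a circuit, $|C|>1$) and $e_i$ ($i$ a loop); $\mathbb{A}_\chi(\mathcal{M})=\mathcal{E}/\Im_\chi(\mathcal{M})$ is a $\chi$-algebra if (UC1) $\chi(I)\ne0$ iff $I$ is independent and (UC2) for unidependents $U'\subseteq U$ there is $\varepsilon_{U,U'}\ne0$ with $\partial e_U=\varepsilon_{U,U'}(\partial e_{U'})e_{U\setminus U'}$. Classes are written $e_X$; $\mathbb{A}=\bigoplus_{k}\mathbb{A}_k$ is graded with $\mathbb{A}_0=\mathbb{K}$ and $\mathbb{A}_k$ spanned by $e_I$, $|I|=k$. For a non-loop $x$, the contraction $\mathcal{M}/x$ carries the $\chi$-algebra $\mathbb{A}(\mathcal{M}/x)$ defined with $\chi_{\mathcal{M}/x}(I)=\chi(I*x)$ (generators $e_i$, $i\ne x$), and $\mathfrak{p}_x:\mathbb{A}(\mathcal{M})\to\mathbb{A}(\mathcal{M}/x)$ is the linear map with, for $I$ independent: $\mathfrak{p}_x(e_I)=e_{I\setminus x}$ if $x\in I$; $\mathfrak{p}_x(e_I)=\frac{\chi((I\setminus y)*x)}{\chi((I\setminus y)*y)}e_{I\setminus y}$ if some $y\in I$ is parallel to $x$; $0$ otherwise. These constructions are applied iteratively to successive contractions (with their induced maps $\chi$). For an ordered independent set $I^\sigma=(i_{\sigma(1)},\dots,i_{\sigma(\ell)})$, the iterated residue $\mathfrak{p}_{I^\sigma}:\mathbb{A}_\ell\to\mathbb{K}$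 is $\mathfrak{p}_{I^\sigma}=\mathfrak{p}_{i_{\sigma(1)}}\circ\mathfrak{p}_{i_{\sigma(2)}}\circ\cdots\circ\mathfrak{p}_{i_{\sigma(\ell)}}$, where $\mathfrak{p}_{i_{\sigma(\ell)}}$ is applied first, on $\mathbb{A}(\mathcal{M})$, then $\mathfrak{p}_{i_{\sigma(\ell-1)}}$ on $\mathbb{A}(\mathcal{M}/i_{\sigma(\ell)})$, etc., landing in degree $0$, identified with $\mathbb{K}$. The flag of $I^\sigma$ is the chain of flats $\mathbf{Flag}(I^\sigma):\ \mathrm{cl}(\{i_{\sigma(\ell)}\})\subsetneq\mathrm{cl}(\{i_{\sigma(\ell)},i_{\sigma(\ell-1)}\})\subsetneq\cdots\subsetneq\mathrm{cl}(I)$. -}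

module Defs where

open import Level using (Level; _⊔_) renaming (suc to lsuc)
open import Data.Bool using (Bool; true; false; if_then_else_)
open import Data.Nat using (ℕ; zero; suc) renaming (_<_ to _<ℕ_; _+_ to _+ℕ_)
open import Data.Fin using (Fin; _<_; _<?_; _≟_)
open import Data.Fin.Properties using (any?; all?)
open import Data.Fin.Subset renaming (_-_ to _⊖_) using (Subset; _∈_; _∉_; _⊆_; ⁅_⁆; _∪_; _─_; ⊥; ∣_∣)
open import Data.Fin.Subset.Properties using (_∈?_; _⊆?_)
open import Data.Fin.Permutation using (Permutation′; _⟨$⟩ʳ_)
open import Data.List using (List; []; _∷_; _++_; [_]; map; foldr; filter; length; tabulate; reverse)
open import Data.List.Relation.Binary.Pointwise using (Pointwise)
open import Data.Vec using (Vec; lookup) renaming ([] to []ᵥ; _∷_ to _∷ᵥ_)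
open import Data.Vec.Properties using (≡-dec)
import Data.Bool as B
open import Data.Product using (Σ; ∃; _×_; _,_)
open import Data.Sum using (_⊎_)
open import Relation.Nullary using (¬_; Dec; yes; no; does; ¬?)
open import Relation.Nullary.Decidable using (_×-dec_; _→-dec_)
open import Relation.Binary.PropositionalEquality using (_≡_; _≢_)
open import Algebra.Bundles using (CommutativeRing)
import Data.List.Relation.Unary.Unique.DecPropositional as UniqueDec

record Field (c ℓ : Level) : Set (lsuc (c ⊔ ℓ)) where
  field
    commutativeRing : CommutativeRing c ℓ
  open CommutativeRing commutativeRing public
  field
    _⁻¹        : Carrier → Carrier
    1≉0        : ¬ (1# ≈ 0#)
    ⁻¹-inverse : ∀ x → ¬ (x ≈ 0#) → x * (x ⁻¹) ≈ 1#

elems : ∀ {n} → Subset n → List (Fin n)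
elems {zero}  []ᵥ      = []
elems {suc n} (b ∷ᵥ p) = (if b then Fin.zero ∷ [] else []) ++ map Fin.suc (elems p)

fromList : ∀ {n} → List (Fin n) → Subset n
fromList = foldr (λ x s → ⁅ x ⁆ ∪ s) ⊥

vecSet : ∀ {n ℓ} → Vec (Fin n) ℓ → Subset n
vecSet []ᵥ       = ⊥
vecSet (x ∷ᵥ xs) = ⁅ x ⁆ ∪ vecSet xs

-- a vector listing an (unordered) set in increasing order
StrictlyIncreasing : ∀ {n ℓ} → Vec (Fin n) ℓ → Set
StrictlyIncreasing {ℓ = ℓ} v = ∀ (i j : Fin ℓ) → i < j → lookup v i < lookup v j

listing : ∀ {n ℓ} → Vec (Fin n) ℓ → Permutation′ ℓ → List (Fin n)
listing X σ = tabulate (λ k → lookup X (σ ⟨$⟩ʳ k))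

record RawMatroid (n : ℕ) : Set₁ where
  field
    Indep  : Subset n → Set
    indep? : (I : Subset n) → Dec (Indep I)
open RawMatroid public

record IsMatroid {n : ℕ} (M : RawMatroid n) : Set where
  field
    indep-∅   : Indep M ⊥
    indep-⊆   : ∀ X Y → X ⊆ Y → Indep M Y → Indep M X
    indep-aug : ∀ X Y → Indep M X → Indep M Y → ∣ X ∣ <ℕ ∣ Y ∣ →
                ∃ λ y → y ∈ Y × y ∉ X × Indep M (⁅ y ⁆ ∪ X)

module _ {n : ℕ} (M : RawMatroid n) where

  Circuit : Subset n → Set
  Circuit C = ¬ Indep M C × (∀ x → x ∈ C → Indep M (C ⊖ x))

  circuit? : (C : Subset n) → Dec (Circuit C)
  circuit? C = ¬? (indep? M C) ×-dec all? (λ x → (x ∈? C) →-dec indep? M (C ⊖ x))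

  Loop : Fin n → Set
  Loop i = ¬ Indep M ⁅ i ⁆

  Parallel : Fin n → Fin n → Set
  Parallel x y = x ≢ y × Circuit (⁅ x ⁆ ∪ ⁅ y ⁆)

  parallel? : (x y : Fin n) → Dec (Parallel x y)
  parallel? x y = ¬? (x ≟ y) ×-dec circuit? (⁅ x ⁆ ∪ ⁅ y ⁆)

  Unidependent : Subset n → Set
  Unidependent U = Σ (Subset n) λ C → (C ⊆ U × Circuit C) ×
                     (∀ C′ → C′ ⊆ U → Circuit C′ → C′ ≡ C)

  _∈cl_ : Fin n → Subset n → Set
  x ∈cl X = x ∈ X ⊎ (Σ (Subset n) λ C → Circuit C × x ∈ C × C ⊆ (⁅ x ⁆ ∪ X))

  SameClosure : Subset n → Subset n → Set
  SameClosure A B = ∀ x → (x ∈cl A → x ∈cl B) × (x ∈cl B → x ∈cl A)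

  -- the sets whose closures form Flag(x_1,…,x_ℓ):
  -- {x_1..x_ℓ}, {x_2..x_ℓ}, …, {x_ℓ}  (i.e. cl(I) ⊋ … ⊋ cl({x_ℓ}))
  flagSets : List (Fin n) → List (Subset n)
  flagSets []       = []
  flagSets (x ∷ xs) = fromList (x ∷ xs) ∷ flagSets xs

  SameFlag : List (Fin n) → List (Fin n) → Set
  SameFlag xs ys = Pointwise SameClosure (flagSets xs) (flagSets ys)

-- contraction M/x, kept on the ground set [n] (x becomes a loop, so its
-- generator e_x is zero in the algebra; equivalent to deleting it)
contract : ∀ {n} → Fin n → RawMatroid n → RawMatroid n
contract x M = record
  { Indep  = λ I → x ∉ I × Indep M (⁅ x ⁆ ∪ I)
  ; indep? = λ I → ¬? (x ∈? I) ×-dec indep? M (⁅ x ⁆ ∪ I) }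

module _ {c ℓ : Level} (F : Field c ℓ) where
  open Field F

  sgnPow : ℕ → Carrier
  sgnPow zero    = 1#
  sgnPow (suc k) = - sgnPow k

  -- number of inversions of a list (so that sgn = (-1)^inversions)
  inversions : ∀ {n} → List (Fin n) → ℕ
  inversions []       = 0
  inversions (x ∷ xs) = length (filter (_<? x) xs) +ℕ inversions xs

  -- χ extended to ordered sets: χ(X^σ) = sgn(σ) χ(X); lists with
  -- repetitions (not ordered sets) get the value 0
  χo : ∀ {n} → (Subset n → Carrier) → List (Fin n) → Carrier
  χo χ xs = if does (UniqueDec.unique? _≟_ xs)
              then sgnPow (inversions xs) * χ (fromList xs)
              else 0#

  contractχ : ∀ {n} → Fin n → (Subset n → Carrier) → Subset n → Carrier
  contractχ x χ I = χo χ (elems I ++ [ x ])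

  -- the residue map p_x on an element  c · e_I  (I independent),
  -- producing  c' · e_{I'}  in A(M/x)
  pStep : ∀ {n} → RawMatroid n → (Subset n → Carrier) → Fin n →
          Carrier × Subset n → Carrier × Subset n
  pStep M χ x (a , I) with x ∈? I
  ... | yes _ = (a , I ⊖ x)
  ... | no _ with any? (λ y → (y ∈? I) ×-dec parallel? M x y)
  ...   | yes (y , _) = (a * (χo χ (elems (I ⊖ y) ++ [ x ]) *
                               (χo χ (elems (I ⊖ y) ++ [ y ])) ⁻¹) , I ⊖ y)
  ...   | no _ = (0# , I)

  -- apply p_{x_1}, then p_{x_2} on the contraction, etc.; finally read off
  -- the degree-0 coefficient
  residueGo : ∀ {n} → RawMatroid n → (Subset n → Carrier) → List (Fin n) →
              Carrier × Subset n → Carrier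
  residueGo M χ []       (a , _) = a
  residueGo M χ (x ∷ xs) aI      =
    residueGo (contract x M) (contractχ x χ) xs (pStep M χ x aI)

  -- p_{I^σ}(e_J) for I^σ = (i_1,…,i_ℓ): p_{i_ℓ} is applied first
  iteratedResidue : ∀ {n} → RawMatroid n → (Subset n → Carrier) →
                    List (Fin n) → Subset n → Carrier
  iteratedResidue M χ Iσ J = residueGo M χ (reverse Iσ) (1# , J)

  -- The algebra ℰ, via its monomial basis {e_X}: an element is its
  -- coefficient function Subset n → K.

  Elem : ℕ → Set c
  Elem n = Subset n → Carrier

  prodList : ∀ {a} {A : Set a} → (A → Carrier) → List A → Carrier
  prodList f = foldr (λ a r → f a * r) 1#

  sumList : ∀ {a} {A : Set a} → (A → Carrier) → List A → Carrier
  sumList f = foldr (λ a r → f a + r) 0#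

  -- e_X e_Y = skew(X,Y) e_{X∪Y} for disjoint X, Y, where
  -- skew(X,Y) = ∏_{x∈X, y∈Y, y<x} β_{y,x}   (from e_x e_y = β_{y,x} e_y e_x)
  skew : ∀ {n} → (Fin n → Fin n → Carrier) → Subset n → Subset n → Carrier
  skew β X Y = prodList (λ x → prodList (λ y → if does (y <? x) then β y x else 1#)
                                         (elems Y)) (elems X)

  boundary : ∀ {n} → (Subset n → Carrier) → Subset n → Elem n
  boundary χ X Z =
    sumList (λ i → if does (≡-dec B._≟_ Z (X ⊖ i))
                     then sgnPow (suc (length (filter (_<? i) (elems X)))) * χ (X ⊖ i)
                     else 0#)
            (elems X)

  rmul : ∀ {n} → (Fin n → Fin n → Carrier) → Elem n → Subset n → Elem n
  rmul β f Y Z = if does (Y ⊆? Z) then f (Z ─ Y) * skew β (Z ─ Y) Y else 0#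

  scale : ∀ {n} → Carrier → Elem n → Elem n
  scale ε f Z = ε * f Z

  _≈ᴱ_ : ∀ {n} → Elem n → Elem n → Set ℓ
  f ≈ᴱ g = ∀ Z → f Z ≈ g Z

  record IsChiAlgebra {n : ℕ} (β : Fin n → Fin n → Carrier)
                      (M : RawMatroid n) (χ : Subset n → Carrier) : Set (c ⊔ ℓ) where
    field
      UC1 : ∀ I → (¬ (χ I ≈ 0#) → Indep M I) × (Indep M I → ¬ (χ I ≈ 0#))
      UC2 : ∀ U U′ → Unidependent M U → Unidependent M U′ → U′ ⊆ U →
            Σ Carrier λ ε → ¬ (ε ≈ 0#) ×
              (boundary χ U ≈ᴱ scale ε (rmul β (boundary χ U′) (U ─ U′)))

∃!Perm : ∀ {ℓ} → (Permutation′ ℓ → Set) → Set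
∃!Perm {ℓ} P = Σ (Permutation′ ℓ) λ τ → P τ ×
                 (∀ τ′ → P τ′ → ∀ (i : Fin ℓ) → τ′ ⟨$⟩ʳ i ≡ τ ⟨$⟩ʳ i)

{-# OPTIONS --safe #-}
module Submission where

-- Unfold p_{I^σ} from the right: after the last elements P of I^σ have been processed, the current
-- element is a·e_S in 𝔸(M/P), and the residue along the next element x keeps it alive only if x ∈ S
-- or some y ∈ S is parallel to x in M/P. In both cases the surviving element z satisfies
-- cl(z ∪ P) = cl(x ∪ P), so a nonzero residue peels off a listing J^τ whose flag is that of I^σ;
-- conversely such a flag forces the element removed at every step. The factors collected along the
-- way, χ(T * x * P)/χ(T * z * P) up to signs that cancel, telescope to χ(I^σ)/χ(J^τ). Two listings of an
-- independent set with the same flag coincide, which gives uniqueness of τ.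

open import Defs hiding (_∈cl_)
import Defs
open import Level using (Level)
open import Data.Bool using (true; false)
open import Data.Nat using (ℕ; zero; suc; _+_; _≤_; s≤s; ≤-pred)
open import Data.Nat.Properties using (≤-refl; ≤-trans; ≰⇒>; _≤?_)
import Data.Nat.Properties as ℕ
open import Data.Nat.Tactic.RingSolver using (solve-∀)
open import Data.Fin using (Fin; zero; suc; _≟_; _<?_)
open import Data.Fin.Properties using (any?; <-cmp)
import Data.Fin.Properties as Fin
open import Data.Fin.Subset using (Subset; _∈_; _∉_; _⊆_; ⁅_⁆; _∪_; _─_; _-_; ⊥; ∣_∣)
open import Data.Fin.Subset.Properties
  using ( p⊆p∪q; q⊆p∪q; x∈p∪q⁻; x∈⁅x⁆; x∈⁅y⁆⇒x≡y; x∉⁅y⁆⇒x≢y; p─q⊆p; p─⊥≡p; x∈p∧x≢y⇒x∈p-y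
        ; x∈p⇒∣p-x∣<∣p∣; ⊆-antisym; ⊆-reflexive; ∉⊥; ∣⊥∣≡0; ∪-assoc; ∪-comm; ∪-identityˡ; ∪-identityʳ; _∈?_)
open import Data.Fin.Permutation using (Permutation′; _⟨$⟩ʳ_; _⟨$⟩ˡ_; permutation; inverseˡ; inverseʳ)
import Data.Fin.Permutation as Permutation
open import Data.Vec using (Vec; lookup; here; there) renaming ([] to []ᵥ; _∷_ to _∷ᵥ_)
open import Data.List using (List; []; _∷_; _++_; [_]; map; filter; length; reverse; _ʳ++_; tabulate; allFin)
import Data.List as List
open import Data.List.Properties
  using ( ʳ++-defn; filter-++; length-++; filter-accept; filter-reject; ++-assoc; ++-identityʳ
        ; reverse-involutive; length-reverse; tabulate-cong; tabulate-lookup; length-tabulate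
        ; ∷-injectiveˡ; ∷-injectiveʳ)
open import Data.List.Membership.Propositional using () renaming (_∈_ to _∈ˡ_; _∉_ to _∉ˡ_)
open import Data.List.Membership.Propositional.Properties
  using (∈-map⁺; ∈-map⁻; ∈-allFin; ∈-tabulate⁺; ∈-tabulate⁻; ∈-lookup)
open import Data.List.Membership.Propositional.Properties.WithK using (unique∧set⇒bag)
open import Data.List.Relation.Unary.Any using (here; there; index)
open import Data.List.Relation.Unary.Any.Properties using (lookup-index)
open import Data.List.Relation.Unary.All.Properties using (¬Any⇒All¬; All¬⇒¬Any)
import Data.List.Relation.Unary.All.Properties as All
import Data.List.Relation.Unary.AllPairs as AllPairs
open import Data.List.Relation.Unary.Unique.Propositional using (Unique; []; _∷_)
open import Data.List.Relation.Unary.Unique.Propositional.Properties using (Unique[x∷xs]⇒x∉xs; tabulate⁺)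
import Data.List.Relation.Unary.Unique.Propositional.Properties as Unique
import Data.List.Relation.Unary.Unique.DecPropositional as UniqueDec
open import Data.List.Relation.Binary.Disjoint.Propositional using (Disjoint)
open import Data.List.Relation.Binary.Pointwise using ([]; _∷_)
import Data.List.Relation.Binary.Pointwise as Pointwise
open import Data.List.Relation.Binary.BagAndSetEquality using (∼bag⇒↭)
open import Data.List.Relation.Binary.Permutation.Propositional using (_↭_; ↭-sym; ↭-trans; ↭⇒↭ₛ)
import Data.List.Relation.Binary.Permutation.Propositional as ↭
open import Data.List.Relation.Binary.Permutation.Propositional.Properties using (∈-resp-↭; ↭-reverse; ++⁺ʳ)
import Data.List.Relation.Binary.Permutation.Setoid.Properties as PermutationSetoid
open import Data.Product using (∃; _×_; _,_; proj₁; proj₂)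
open import Data.Sum using (_⊎_; inj₁; inj₂; [_,_]′)
open import Data.Empty using (⊥-elim)
open import Function using (id; _∘_)
open import Function.Bundles using (_⇔_; mk⇔)
open import Relation.Nullary using (¬_; Dec; yes; no; ¬?)
open import Relation.Nullary.Decidable using (_×-dec_; decidable-stable; dec-true; dec-false)
open import Relation.Binary.Definitions using (tri<; tri≈; tri>)
open import Relation.Binary.PropositionalEquality using (_≡_; _≢_; refl; sym; trans; cong; subst)
import Relation.Binary.PropositionalEquality as ≡
import Algebra.Solver.CommutativeMonoid as CommutativeMonoidSolver

private variable
  n ℓ : ℕ
  x y : Fin n
  p q r p′ q′ : Subset n
  xs ys : List (Fin n)

-- Finite subsets and duplicate-free lists

∪-least : p ⊆ r → q ⊆ r → p ∪ q ⊆ r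
∪-least {p = p} {q = q} p⊆r q⊆r x∈p∪q = [ p⊆r , q⊆r ]′ (x∈p∪q⁻ p q x∈p∪q)

∪-mono : p ⊆ p′ → q ⊆ q′ → p ∪ q ⊆ p′ ∪ q′
∪-mono {p′ = p′} {q′ = q′} p⊆p′ q⊆q′ =
  ∪-least (λ h → p⊆p∪q q′ (p⊆p′ h)) (λ h → q⊆p∪q p′ q′ (q⊆q′ h))

⁅⁆-⊆ : x ∈ p → ⁅ x ⁆ ⊆ p
⁅⁆-⊆ {x = x} x∈p y∈⁅x⁆ rewrite x∈⁅y⁆⇒x≡y x y∈⁅x⁆ = x∈p

x∈p─q⇒x∉q : x ∈ p ─ q → x ∉ q
x∈p─q⇒x∉q {p = true ∷ᵥ p}  {q = false ∷ᵥ q} here      ()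
x∈p─q⇒x∉q {p = _ ∷ᵥ p}     {q = _ ∷ᵥ q}     (there h) (there h′) = x∈p─q⇒x∉q h h′

x∈p-y⇒x≢y : x ∈ p - y → x ≢ y
x∈p-y⇒x≢y h = x∉⁅y⁆⇒x≢y (x∈p─q⇒x∉q h)

⁅x⁆∪[p-x]≡p : x ∈ p → ⁅ x ⁆ ∪ (p - x) ≡ p
⁅x⁆∪[p-x]≡p {x = x} {p = p} x∈p = ⊆-antisym (∪-least (⁅⁆-⊆ x∈p) (p─q⊆p p ⁅ x ⁆)) p⊆
  where
    p⊆ : p ⊆ ⁅ x ⁆ ∪ (p - x)
    p⊆ {y} y∈p with y ≟ x
    ... | yes refl = p⊆p∪q (p - x) (x∈⁅x⁆ x)
    ... | no y≢x   = q⊆p∪q ⁅ x ⁆ (p - x) (x∈p∧x≢y⇒x∈p-y y∈p y≢x)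

[⁅x⁆∪p]-x≡p : x ∉ p → (⁅ x ⁆ ∪ p) - x ≡ p
[⁅x⁆∪p]-x≡p {x = x} {p = p} x∉p = ⊆-antisym ⊆p p⊆
  where
    ⊆p : (⁅ x ⁆ ∪ p) - x ⊆ p
    ⊆p h = [ (λ e → ⊥-elim (x∈p-y⇒x≢y h (x∈⁅y⁆⇒x≡y x e))) , (λ h′ → h′) ]′ (x∈p∪q⁻ ⁅ x ⁆ p (p─q⊆p _ _ h))
    p⊆ : p ⊆ (⁅ x ⁆ ∪ p) - x
    p⊆ y∈p = x∈p∧x≢y⇒x∈p-y (q⊆p∪q ⁅ x ⁆ p y∈p) (λ { refl → x∉p y∈p })

∣⁅x⁆∪p∣ : x ∉ p → ∣ ⁅ x ⁆ ∪ p ∣ ≡ suc ∣ p ∣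
∣⁅x⁆∪p∣ {x = zero}  {p = true ∷ᵥ p}  x∉p = ⊥-elim (x∉p here)
∣⁅x⁆∪p∣ {x = zero}  {p = false ∷ᵥ p} x∉p = cong suc (cong ∣_∣ (∪-identityˡ p))
∣⁅x⁆∪p∣ {x = suc x} {p = true ∷ᵥ p}  x∉p = cong suc (∣⁅x⁆∪p∣ (λ h → x∉p (there h)))
∣⁅x⁆∪p∣ {x = suc x} {p = false ∷ᵥ p} x∉p = ∣⁅x⁆∪p∣ (λ h → x∉p (there h))

suc∣p-x∣ : x ∈ p → suc ∣ p - x ∣ ≡ ∣ p ∣
suc∣p-x∣ {x = zero}  {p = true ∷ᵥ p}  here      = cong suc (cong ∣_∣ (p─⊥≡p p))
suc∣p-x∣ {x = suc x} {p = true ∷ᵥ p}  (there h) = cong suc (suc∣p-x∣ h)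
suc∣p-x∣ {x = suc x} {p = false ∷ᵥ p} (there h) = suc∣p-x∣ h

∣p∣≡0⇒p≡⊥ : ∣ p ∣ ≡ 0 → p ≡ ⊥
∣p∣≡0⇒p≡⊥ {p = []ᵥ}       _ = refl
∣p∣≡0⇒p≡⊥ {p = false ∷ᵥ p} e = cong (false ∷ᵥ_) (∣p∣≡0⇒p≡⊥ e)

Unique-∷ : x ∉ˡ xs → Unique xs → Unique (x ∷ xs)
Unique-∷ {xs = xs} x∉xs u = ¬Any⇒All¬ xs x∉xs ∷ u

Unique-++⁻ˡ : ∀ xs → Unique (xs ++ ys) → Unique xs
Unique-++⁻ˡ []       _          = []
Unique-++⁻ˡ (x ∷ xs) (x∉ ∷ u) = All.++⁻ˡ xs x∉ ∷ Unique-++⁻ˡ xs u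

Unique-resp-↭ : xs ↭ ys → Unique xs → Unique ys
Unique-resp-↭ xs↭ys = PermutationSetoid.Unique-resp-↭ (≡.setoid _) (↭⇒↭ₛ xs↭ys)

Unique-ʳ++⁺ : Unique xs → Unique ys → Disjoint xs ys → Unique (xs ʳ++ ys)
Unique-ʳ++⁺ {xs = []}     _           v _ = v
Unique-ʳ++⁺ {xs = x ∷ xs} (x∉xs ∷ u) v d =
  Unique-ʳ++⁺ u (Unique-∷ (λ x∈ys → d (here refl , x∈ys)) v) λ where
    (z∈xs , here refl) → All¬⇒¬Any x∉xs z∈xs
    (z∈xs , there z∈ys) → d (there z∈xs , z∈ys)

Unique-ʳ++⁻ : ∀ xs → Unique (xs ʳ++ ys) → Unique xs × Unique ys × Disjoint xs ys
Unique-ʳ++⁻ []       u = [] , u , λ ()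
Unique-ʳ++⁻ (x ∷ xs) u with Unique-ʳ++⁻ xs u
... | uxs , x∉ys ∷ uys , d = Unique-∷ (λ x∈xs → d (x∈xs , here refl)) uxs , uys , λ where
  (here refl , z∈ys)  → All¬⇒¬Any x∉ys z∈ys
  (there z∈xs , z∈ys) → d (z∈xs , there z∈ys)

∈-fromList⁺ : x ∈ˡ xs → x ∈ fromList xs
∈-fromList⁺ {xs = y ∷ ys} (here refl) = p⊆p∪q (fromList ys) (x∈⁅x⁆ y)
∈-fromList⁺ {xs = y ∷ ys} (there h)   = q⊆p∪q ⁅ y ⁆ (fromList ys) (∈-fromList⁺ h)

∈-fromList⁻ : x ∈ fromList xs → x ∈ˡ xs
∈-fromList⁻ {xs = []}     h = ⊥-elim (∉⊥ h)
∈-fromList⁻ {xs = y ∷ ys} h =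
  [ (λ e → here (x∈⁅y⁆⇒x≡y y e)) , (λ h′ → there (∈-fromList⁻ h′)) ]′ (x∈p∪q⁻ ⁅ y ⁆ (fromList ys) h)

fromList-++ : ∀ xs → fromList (xs ++ ys) ≡ fromList xs ∪ fromList ys
fromList-++ []       = sym (∪-identityˡ _)
fromList-++ (x ∷ xs) = trans (cong (⁅ x ⁆ ∪_) (fromList-++ xs)) (sym (∪-assoc ⁅ x ⁆ _ _))

fromList-↭ : xs ↭ ys → fromList xs ≡ fromList ys
fromList-↭ xs↭ys = ⊆-antisym
  (λ h → ∈-fromList⁺ (∈-resp-↭ xs↭ys (∈-fromList⁻ h)))
  (λ h → ∈-fromList⁺ (∈-resp-↭ (↭-sym xs↭ys) (∈-fromList⁻ h)))

fromList-ʳ++ : ∀ xs → fromList (xs ʳ++ ys) ≡ fromList xs ∪ fromList ys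
fromList-ʳ++ xs = trans (cong fromList (ʳ++-defn xs))
  (trans (fromList-++ (reverse xs)) (cong (_∪ _) (fromList-↭ (↭-reverse xs))))

∣fromList∣ : Unique xs → ∣ fromList xs ∣ ≡ length xs
∣fromList∣ {n} {xs = []} _ = ∣⊥∣≡0 n
∣fromList∣ {xs = x ∷ xs} (x∉xs ∷ u) =
  trans (∣⁅x⁆∪p∣ (All¬⇒¬Any x∉xs ∘ ∈-fromList⁻)) (cong suc (∣fromList∣ u))

∈-elems⁺ : x ∈ p → x ∈ˡ elems p
∈-elems⁺ {p = true ∷ᵥ p}  here      = here refl
∈-elems⁺ {p = true ∷ᵥ p}  (there h) = there (∈-map⁺ suc (∈-elems⁺ h))
∈-elems⁺ {p = false ∷ᵥ p} (there h) = ∈-map⁺ suc (∈-elems⁺ h)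

∈-elems⁻ : x ∈ˡ elems p → x ∈ p
∈-elems⁻ {p = true ∷ᵥ p}  (here refl) = here
∈-elems⁻ {p = true ∷ᵥ p}  (there h) with ∈-map⁻ suc h
... | _ , h′ , refl = there (∈-elems⁻ h′)
∈-elems⁻ {p = false ∷ᵥ p} h with ∈-map⁻ suc h
... | _ , h′ , refl = there (∈-elems⁻ h′)

elems-unique : ∀ (p : Subset n) → Unique (elems p)
elems-unique []ᵥ          = []
elems-unique (true ∷ᵥ p)  = Unique-∷ zero∉ (Unique.map⁺ Fin.suc-injective (elems-unique p))
  where zero∉ : zero ∉ˡ map suc (elems p)
        zero∉ h with ∈-map⁻ suc h
        ... | _ , _ , ()
elems-unique (false ∷ᵥ p) = Unique.map⁺ Fin.suc-injective (elems-unique p)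

elems-fromList-↭ : Unique xs → elems (fromList xs) ↭ xs
elems-fromList-↭ {xs = xs} u = ∼bag⇒↭ (unique∧set⇒bag (elems-unique (fromList xs)) u
  (mk⇔ (∈-fromList⁻ ∘ ∈-elems⁻) (∈-elems⁺ ∘ ∈-fromList⁺)))

module MatroidClosure {n : ℕ} {M : RawMatroid n} (isM : IsMatroid M) where
  open IsMatroid isM

  private variable
    z : Fin n
    B D S W X Y Z : Subset n
    zs : List (Fin n)

  _∈cl_ : Fin n → Subset n → Set
  _∈cl_ = Defs._∈cl_ M

  indep-mono : X ⊆ Y → Indep M Y → Indep M X
  indep-mono {X} {Y} = indep-⊆ X Y

  dependent⇒⊇circuit : ∀ k → ∣ D ∣ ≤ k → ¬ Indep M D → ∃ λ C → C ⊆ D × Circuit M C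
  dependent⇒⊇circuit {D} k ∣D∣≤k dep with any? (λ x → (x ∈? D) ×-dec ¬? (indep? M (D - x)))
  ... | no minimal =
    D , id , dep , λ x x∈D → decidable-stable (indep? M (D - x)) (λ d → minimal (x , x∈D , d))
  dependent⇒⊇circuit zero ∣D∣≤0 dep | yes (x , x∈D , _)
    with () ← ≤-trans (x∈p⇒∣p-x∣<∣p∣ x∈D) ∣D∣≤0
  dependent⇒⊇circuit (suc k) ∣D∣≤1+k dep | yes (x , x∈D , depD-x)
    with dependent⇒⊇circuit k (≤-pred (≤-trans (x∈p⇒∣p-x∣<∣p∣ x∈D) ∣D∣≤1+k)) depD-x
  ... | C , C⊆D-x , circuit = C , (λ h → p─q⊆p _ _ (C⊆D-x h)) , circuit

  ∈cl-of-dependent : Indep M X → ¬ Indep M (⁅ z ⁆ ∪ X) → z ∈cl X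
  ∈cl-of-dependent {X} {z} indX dep with dependent⇒⊇circuit _ ≤-refl dep
  ... | C , C⊆zX , circuit with z ∈? C
  ... | yes z∈C = inj₂ (C , circuit , z∈C , C⊆zX)
  ... | no z∉C = ⊥-elim (proj₁ circuit (indep-mono C⊆X indX))
    where
      C⊆X : C ⊆ X
      C⊆X c∈C = [ (λ c∈z → ⊥-elim (z∉C (subst (_∈ C) (x∈⁅y⁆⇒x≡y z c∈z) c∈C))) , id ]′
                  (x∈p∪q⁻ ⁅ z ⁆ X (C⊆zX c∈C))

  ∉cl-of-independent : ⁅ z ⁆ ∪ X ⊆ Y → Indep M Y → z ∉ X → ¬ (z ∈cl X)
  ∉cl-of-independent _ _ z∉X (inj₁ z∈X) = z∉X z∈X
  ∉cl-of-independent zX⊆Y indY _ (inj₂ (C , circuit , _ , C⊆zX)) =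
    proj₁ circuit (indep-mono (λ h → zX⊆Y (C⊆zX h)) indY)

  indep-∪-of-∉cl : Indep M X → ¬ (z ∈cl X) → Indep M (⁅ z ⁆ ∪ X)
  indep-∪-of-∉cl indX z∉clX = decidable-stable (indep? M _) (z∉clX ∘ ∈cl-of-dependent indX)

  ∈cl-mono : X ⊆ Y → z ∈cl X → z ∈cl Y
  ∈cl-mono X⊆Y (inj₁ z∈X) = inj₁ (X⊆Y z∈X)
  ∈cl-mono X⊆Y (inj₂ (C , circuit , z∈C , C⊆zX)) =
    inj₂ (C , circuit , z∈C , λ h → ∪-mono id X⊆Y (C⊆zX h))

  -- a circuit through z, minus z
  ∈cl⇒dependent-extension : z ∈cl Y → z ∉ Y → ∃ λ D → D ⊆ Y × Indep M D × ¬ Indep M (⁅ z ⁆ ∪ D)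
  ∈cl⇒dependent-extension (inj₁ z∈Y) z∉Y = ⊥-elim (z∉Y z∈Y)
  ∈cl⇒dependent-extension {z} {Y} (inj₂ (C , (depC , minimal) , z∈C , C⊆zY)) _ =
    C - z , C-z⊆Y , minimal z z∈C , λ ind → depC (indep-mono C⊆z∪C-z ind)
    where
      C-z⊆Y : C - z ⊆ Y
      C-z⊆Y h = [ (λ e → ⊥-elim (x∈p-y⇒x≢y h (x∈⁅y⁆⇒x≡y z e))) , id ]′
                  (x∈p∪q⁻ ⁅ z ⁆ Y (C⊆zY (p─q⊆p C ⁅ z ⁆ h)))
      C⊆z∪C-z : C ⊆ ⁅ z ⁆ ∪ (C - z)
      C⊆z∪C-z {c} c∈C with c ≟ z
      ... | yes refl = p⊆p∪q _ (x∈⁅x⁆ z)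
      ... | no c≢z   = q⊆p∪q _ _ (x∈p∧x≢y⇒x∈p-y c∈C c≢z)

  Spans : Subset n → Subset n → Set
  Spans B W = ∀ {w} → w ∈ W → w ∈ B ⊎ ¬ Indep M (⁅ w ⁆ ∪ B)

  extend-spanning : ∀ (ws : List (Fin n)) → B ⊆ W → Indep M B →
    ∃ λ B′ → B ⊆ B′ × B′ ⊆ W × Indep M B′ ×
             (∀ {w} → w ∈ˡ ws → w ∈ W → w ∈ B′ ⊎ ¬ Indep M (⁅ w ⁆ ∪ B′))
  extend-spanning []       B⊆W indB = _ , id , B⊆W , indB , λ ()
  extend-spanning {B} {W} (w ∷ ws) B⊆W indB with (w ∈? W) ×-dec indep? M (⁅ w ⁆ ∪ B)
  ... | yes (w∈W , indwB) with extend-spanning ws (∪-least (⁅⁆-⊆ w∈W) B⊆W) indwB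
  ...   | B′ , wB⊆B′ , B′⊆W , indB′ , spans =
    B′ , (λ h → wB⊆B′ (q⊆p∪q _ _ h)) , B′⊆W , indB′ , λ where
      (here refl) _ → inj₁ (wB⊆B′ (p⊆p∪q B (x∈⁅x⁆ w)))
      (there h)     → spans h
  extend-spanning {B} {W} (w ∷ ws) B⊆W indB | no ¬wB with extend-spanning ws B⊆W indB
  ... | B′ , B⊆B′ , B′⊆W , indB′ , spans = B′ , B⊆B′ , B′⊆W , indB′ , λ where
      (here refl) w∈W → inj₂ (λ indwB′ → ¬wB (w∈W , indep-mono (∪-mono id B⊆B′) indwB′))
      (there h)       → spans h

  extend-to-spanning : B ⊆ W → Indep M B → ∃ λ B′ → B ⊆ B′ × B′ ⊆ W × Indep M B′ × Spans B′ W
  extend-to-spanning B⊆W indB with extend-spanning (allFin n) B⊆W indB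
  ... | B′ , B⊆B′ , B′⊆W , indB′ , spans = B′ , B⊆B′ , B′⊆W , indB′ , spans (∈-allFin _)

  spanning-bound : Indep M B → Spans B W → D ⊆ W → Indep M D → ∣ D ∣ ≤ ∣ B ∣
  spanning-bound {B} {W} {D} indB spans D⊆W indD with ∣ D ∣ ≤? ∣ B ∣
  ... | yes ∣D∣≤∣B∣ = ∣D∣≤∣B∣
  ... | no ∣D∣≰∣B∣ with indep-aug B D indB indD (≰⇒> ∣D∣≰∣B∣)
  ... | y , y∈D , y∉B , indyB = ⊥-elim ([ y∉B , (λ dep → dep indyB) ]′ (spans (D⊆W y∈D)))

  -- Otherwise extend D to a spanning subset D′ of W ∪ z: then z ∉ D′, so
  -- suc ∣ B ∣ = ∣ ⁅ z ⁆ ∪ B ∣ ≤ ∣ D′ ∣ ≤ ∣ B ∣.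
  spanning-absorbs : B ⊆ W → Indep M B → Spans B W → D ⊆ W → Indep M D →
                     ¬ Indep M (⁅ z ⁆ ∪ D) → z ∈ B ⊎ ¬ Indep M (⁅ z ⁆ ∪ B)
  spanning-absorbs {B} {W} {D} {z} B⊆W indB spans D⊆W indD depzD with z ∈? B | indep? M (⁅ z ⁆ ∪ B)
  ... | yes z∈B | _         = inj₁ z∈B
  ... | no _    | no depzB  = inj₂ depzB
  ... | no z∉B  | yes indzB with extend-to-spanning {W = ⁅ z ⁆ ∪ W} (λ h → q⊆p∪q _ _ (D⊆W h)) indD
  ... | D′ , D⊆D′ , D′⊆zW , indD′ , D′spans =
    ⊥-elim (ℕ.<-irrefl refl (subst (_≤ ∣ B ∣) (∣⁅x⁆∪p∣ z∉B)
      (≤-trans (spanning-bound indD′ D′spans (∪-mono id B⊆W) indzB)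
               (spanning-bound indB spans D′⊆W indD′))))
    where
      z∉D′ : z ∉ D′
      z∉D′ z∈D′ = depzD (indep-mono (∪-least (⁅⁆-⊆ z∈D′) D⊆D′) indD′)
      D′⊆W : D′ ⊆ W
      D′⊆W h = [ (λ e → ⊥-elim (z∉D′ (subst (_∈ D′) (x∈⁅y⁆⇒x≡y z e) h))) , id ]′
                 (x∈p∪q⁻ ⁅ z ⁆ W (D′⊆zW h))

  spans-closure : B ⊆ X → Indep M B → Spans B X → z ∈cl X → z ∈ B ⊎ ¬ Indep M (⁅ z ⁆ ∪ B)
  spans-closure {X = X} {z = z} B⊆X indB spans z∈clX with z ∈? X
  ... | yes z∈X = spans z∈X
  ... | no z∉X with ∈cl⇒dependent-extension z∈clX z∉X
  ... | D , D⊆X , indD , depzD = spanning-absorbs B⊆X indB spans D⊆X indD depzD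

  ∈cl-idem : (∀ {y} → y ∈ Y → y ∈cl X) → z ∈cl Y → z ∈cl X
  ∈cl-idem {Y} {X} {z} Y⊆clX z∈clY with z ∈? Y
  ... | yes z∈Y = Y⊆clX z∈Y
  ... | no z∉Y with extend-to-spanning {W = X} (λ h → ⊥-elim (∉⊥ h)) indep-∅
                  | ∈cl⇒dependent-extension z∈clY z∉Y
  ... | B , _ , B⊆X , indB , spans | D , D⊆Y , indD , depzD =
    [ (λ z∈B → inj₁ (B⊆X z∈B)) , (λ depzB → ∈cl-mono B⊆X (∈cl-of-dependent indB depzB)) ]′
      (spanning-absorbs (q⊆p∪q Y B) indB spansYB (λ h → p⊆p∪q B (D⊆Y h)) indD depzD)
    where
      spansYB : Spans B (Y ∪ B)
      spansYB h = [ (λ y∈Y → spans-closure B⊆X indB spans (Y⊆clX y∈Y)) , inj₁ ]′ (x∈p∪q⁻ Y B h)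

  SameClosure-refl : SameClosure M X X
  SameClosure-refl _ = id , id

  SameClosure-sym : SameClosure M X Y → SameClosure M Y X
  SameClosure-sym X~Y z = proj₂ (X~Y z) , proj₁ (X~Y z)

  SameClosure-trans : SameClosure M X Y → SameClosure M Y Z → SameClosure M X Z
  SameClosure-trans X~Y Y~Z z = proj₁ (Y~Z z) ∘ proj₁ (X~Y z) , proj₂ (X~Y z) ∘ proj₂ (Y~Z z)

  sameClosure : (∀ {x} → x ∈ X → x ∈cl Y) → (∀ {y} → y ∈ Y → y ∈cl X) → SameClosure M X Y
  sameClosure X⊆clY Y⊆clX _ = ∈cl-idem X⊆clY , ∈cl-idem Y⊆clX

  SameClosure-∪ˡ : ∀ Z → SameClosure M X Y → SameClosure M (Z ∪ X) (Z ∪ Y)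
  SameClosure-∪ˡ {X} {Y} Z X~Y = sameClosure (⊆cl X~Y) (⊆cl (SameClosure-sym X~Y))
    where
      ⊆cl : ∀ {A B} → SameClosure M A B → ∀ {x} → x ∈ Z ∪ A → x ∈cl (Z ∪ B)
      ⊆cl {A} {B} A~B {x} h =
        [ (λ x∈Z → inj₁ (p⊆p∪q B x∈Z)) , (λ x∈A → ∈cl-mono (q⊆p∪q Z B) (proj₁ (A~B x) (inj₁ x∈A))) ]′
          (x∈p∪q⁻ Z A h)

  indep-resp-SameClosure : ∀ xs → Indep M (fromList xs ∪ X) → Indep M Y → SameClosure M X Y →
                           (∀ {x} → x ∈ˡ xs → x ∉ X) → Indep M (fromList xs ∪ Y)
  indep-resp-SameClosure {Y = Y} [] _ indY _ _ = subst (Indep M) (sym (∪-identityˡ Y)) indY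
  indep-resp-SameClosure {X} {Y} (x ∷ xs) ind indY X~Y xs∩X≡∅ = extend (x ∈? fromList xs)
    where
      IH : Indep M (fromList xs ∪ Y)
      IH = indep-resp-SameClosure xs (indep-mono (∪-mono (q⊆p∪q ⁅ x ⁆ _) id) ind) indY X~Y (xs∩X≡∅ ∘ there)
      extend : Dec (x ∈ fromList xs) → Indep M (fromList (x ∷ xs) ∪ Y)
      extend (yes x∈xs) = indep-mono (∪-least (∪-least (⁅⁆-⊆ (p⊆p∪q Y x∈xs)) (p⊆p∪q Y)) (q⊆p∪q _ Y)) IH
      extend (no x∉xs)  = subst (Indep M) (sym (∪-assoc ⁅ x ⁆ (fromList xs) Y)) (indep-∪-of-∉cl IH x∉cl)
        where
          x∉cl : ¬ (x ∈cl (fromList xs ∪ Y))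
          x∉cl x∈cl = ∉cl-of-independent (⊆-reflexive (sym (∪-assoc ⁅ x ⁆ (fromList xs) X))) ind
            (λ h → [ x∉xs , xs∩X≡∅ (here refl) ]′ (x∈p∪q⁻ _ _ h))
            (proj₂ (SameClosure-∪ˡ (fromList xs) X~Y x) x∈cl)

  SameFlag-refl : SameFlag M xs xs
  SameFlag-refl = Pointwise.refl SameClosure-refl

  SameFlag-sym : SameFlag M xs ys → SameFlag M ys xs
  SameFlag-sym = Pointwise.symmetric SameClosure-sym

  SameFlag-trans : SameFlag M xs ys → SameFlag M ys zs → SameFlag M xs zs
  SameFlag-trans = Pointwise.transitive SameClosure-trans

  SameFlag-head : SameFlag M xs ys → SameClosure M (fromList xs) (fromList ys)
  SameFlag-head {[]}    {[]}    []      = SameClosure-refl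
  SameFlag-head {_ ∷ _} {_ ∷ _} (h ∷ _) = h

  SameFlag-∷ : ∀ t → SameFlag M xs ys → SameFlag M (t ∷ xs) (t ∷ ys)
  SameFlag-∷ t flag = SameClosure-∪ˡ ⁅ t ⁆ (SameFlag-head flag) ∷ flag

  SameFlag-ʳ++ : ∀ ts → SameFlag M xs ys → SameFlag M (ts ʳ++ xs) (ts ʳ++ ys)
  SameFlag-ʳ++ []       flag = flag
  SameFlag-ʳ++ (t ∷ ts) flag = SameFlag-ʳ++ ts (SameFlag-∷ t flag)

  SameFlag-ʳ++⁻ : ∀ ts us → length ts ≡ length us → SameFlag M (ts ʳ++ xs) (us ʳ++ ys) → SameFlag M xs ys
  SameFlag-ʳ++⁻ []       []       _ flag = flag
  SameFlag-ʳ++⁻ (t ∷ ts) (u ∷ us) e flag with SameFlag-ʳ++⁻ ts us (ℕ.suc-injective e) flag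
  ... | _ ∷ flag′ = flag′

  -- Distinct heads would put one head in the closure of the other list.
  SameFlag⇒≡ : Indep M S → fromList xs ⊆ S → fromList ys ⊆ S → Unique xs → Unique ys →
               SameFlag M xs ys → xs ≡ ys
  SameFlag⇒≡ {xs = []} {[]} _ _ _ _ _ [] = refl
  SameFlag⇒≡ {S} {x ∷ xs} {y ∷ ys} indS xs⊆S ys⊆S (x∉xs ∷ uxs) (y∉ys ∷ uys) (head ∷ flag)
    with SameFlag⇒≡ indS (λ h → xs⊆S (q⊆p∪q _ _ h)) (λ h → ys⊆S (q⊆p∪q _ _ h)) uxs uys flag
  ... | refl with x ≟ y
  ...   | yes refl = refl
  ...   | no x≢y   = ⊥-elim (∉cl-of-independent (∪-least (λ h → ys⊆S (p⊆p∪q _ h)) xs⊆S) indS y∉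
                               (proj₂ (head y) (inj₁ (p⊆p∪q _ (x∈⁅x⁆ y)))))
    where
      y∉ : y ∉ fromList (x ∷ xs)
      y∉ h = [ (λ e → x≢y (sym (x∈⁅y⁆⇒x≡y x e))) , (λ h′ → All¬⇒¬Any y∉ys (∈-fromList⁻ h′)) ]′
               (x∈p∪q⁻ _ _ h)

  indep-ʳ++⁻ʳ : ∀ ys → Indep M (fromList (ys ʳ++ xs)) → Indep M (fromList xs)
  indep-ʳ++⁻ʳ ys ind = indep-mono (q⊆p∪q _ _) (subst (Indep M) (fromList-ʳ++ ys) ind)

  ʳ++-prefix-∉cl : ∀ T xs → Unique (T ʳ++ xs) → Indep M (fromList (T ʳ++ xs)) → z ∈ˡ T → ¬ z ∈cl fromList xs
  ʳ++-prefix-∉cl T xs uTxs ind z∈T =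
    ∉cl-of-independent (∪-mono (⁅⁆-⊆ (∈-fromList⁺ z∈T)) id) (subst (Indep M) (fromList-ʳ++ T) ind)
      (λ z∈xs → proj₂ (proj₂ (Unique-ʳ++⁻ T uTxs)) (z∈T , ∈-fromList⁻ z∈xs))

  ∈cl-ʳ++-head : ∀ T {j} xs → Unique (T ʳ++ j ∷ xs) → Indep M (fromList (T ʳ++ j ∷ xs)) →
                 z ∈ fromList (j ∷ T) → z ∈cl fromList (j ∷ xs) → z ≡ j
  ∈cl-ʳ++-head {z} T {j} xs u ind z∈jT z∈cl with z ≟ j
  ... | yes z≡j = z≡j
  ... | no z≢j  = ⊥-elim (ʳ++-prefix-∉cl T (j ∷ xs) u ind z∈T z∈cl)
    where z∈T = [ (λ e → ⊥-elim (z≢j (x∈⁅y⁆⇒x≡y j e))) , ∈-fromList⁻ ]′ (x∈p∪q⁻ ⁅ j ⁆ (fromList T) z∈jT)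

  ʳ++-replace-head : ∀ T {j x} xs → Unique (T ʳ++ j ∷ xs) → Indep M (fromList (T ʳ++ j ∷ xs)) →
    Unique (x ∷ xs) → Indep M (fromList (x ∷ xs)) → SameClosure M (fromList (j ∷ xs)) (fromList (x ∷ xs)) →
    Unique (T ʳ++ x ∷ xs) × Indep M (fromList (T ʳ++ x ∷ xs))
  ʳ++-replace-head T {j} {x} xs uK indK uxxs indxxs jxs~xxs =
    Unique-ʳ++⁺ (proj₁ (Unique-ʳ++⁻ T uK)) uxxs T∩xxs≡∅ ,
    subst (Indep M) (sym (fromList-ʳ++ T))
      (indep-resp-SameClosure T (subst (Indep M) (fromList-ʳ++ T) indK) indxxs jxs~xxs
        (λ z∈T z∈jxs → T∩jxs≡∅ (z∈T , ∈-fromList⁻ z∈jxs)))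
    where
      T∩jxs≡∅ = proj₂ (proj₂ (Unique-ʳ++⁻ T uK))
      T∩xxs≡∅ : Disjoint T (x ∷ xs)
      T∩xxs≡∅ (x∈T , here refl) = ʳ++-prefix-∉cl T (j ∷ xs) uK indK x∈T (proj₂ (jxs~xxs x) (inj₁ (p⊆p∪q _ (x∈⁅x⁆ x))))
      T∩xxs≡∅ (z∈T , there z∈xs) = T∩jxs≡∅ (z∈T , there z∈xs)

contractAll : ∀ {n} → List (Fin n) → RawMatroid n → RawMatroid n
contractAll []      M = M
contractAll (x ∷ P) M = contract x (contractAll P M)

Parallel-sym : ∀ {n} {N : RawMatroid n} {x y : Fin n} → Parallel N x y → Parallel N y x
Parallel-sym {N = N} {x} {y} (x≢y , circuit) = x≢y ∘ sym , subst (Circuit N) (∪-comm ⁅ x ⁆ ⁅ y ⁆) circuit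

module Contraction {n : ℕ} {M : RawMatroid n} (isM : IsMatroid M) where
  open MatroidClosure isM

  private variable
    X Y : Subset n

  indep-contractAll⁻ : ∀ P → Indep (contractAll P M) Y → (∀ {x} → x ∈ˡ P → x ∉ Y) × Indep M (Y ∪ fromList P)
  indep-contractAll⁻ {Y} []      ind = (λ ()) , subst (Indep M) (sym (∪-identityʳ Y)) ind
  indep-contractAll⁻ {Y} (x ∷ P) (x∉Y , ind) with indep-contractAll⁻ P ind
  ... | P∩xY≡∅ , indxYP = P∩Y≡∅ , indep-mono (⊆-reflexive reassoc) indxYP
    where
      P∩Y≡∅ : ∀ {p} → p ∈ˡ x ∷ P → p ∉ Y
      P∩Y≡∅ (here refl) = x∉Y
      P∩Y≡∅ (there p∈P) = P∩xY≡∅ p∈P ∘ q⊆p∪q ⁅ x ⁆ Y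
      reassoc : Y ∪ (⁅ x ⁆ ∪ fromList P) ≡ (⁅ x ⁆ ∪ Y) ∪ fromList P
      reassoc = trans (sym (∪-assoc Y ⁅ x ⁆ _)) (cong (_∪ fromList P) (∪-comm Y ⁅ x ⁆))

  indep-contractAll⁺ : ∀ P → Unique P → (∀ {x} → x ∈ˡ P → x ∉ Y) → Indep M (Y ∪ fromList P) →
                       Indep (contractAll P M) Y
  indep-contractAll⁺ [] _ _ ind = indep-mono (p⊆p∪q ⊥) ind
  indep-contractAll⁺ {Y} (x ∷ P) (x∉P ∷ uP) P∩Y≡∅ ind =
    P∩Y≡∅ (here refl) , indep-contractAll⁺ P uP P∩xY≡∅ (indep-mono (⊆-reflexive reassoc) ind)
    where
      P∩xY≡∅ : ∀ {p} → p ∈ˡ P → p ∉ ⁅ x ⁆ ∪ Y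
      P∩xY≡∅ p∈P h = [ (λ e → All¬⇒¬Any x∉P (subst (_∈ˡ P) (x∈⁅y⁆⇒x≡y x e) p∈P)) , P∩Y≡∅ (there p∈P) ]′
                       (x∈p∪q⁻ _ _ h)
      reassoc : (⁅ x ⁆ ∪ Y) ∪ fromList P ≡ Y ∪ (⁅ x ⁆ ∪ fromList P)
      reassoc = trans (cong (_∪ fromList P) (∪-comm ⁅ x ⁆ Y)) (∪-assoc Y ⁅ x ⁆ _)

  indep-contractAll-mono : ∀ P → Unique P → X ⊆ Y → Indep (contractAll P M) Y → Indep (contractAll P M) X
  indep-contractAll-mono P uP X⊆Y ind with indep-contractAll⁻ P ind
  ... | P∩Y≡∅ , indYP = indep-contractAll⁺ P uP (λ p∈P → P∩Y≡∅ p∈P ∘ X⊆Y) (indep-mono (∪-mono X⊆Y id) indYP)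

  parallel⇒∈cl : ∀ P → Unique P → Parallel (contractAll P M) x y → y ∈cl fromList (x ∷ P)
  parallel⇒∈cl {x} {y} P uP (x≢y , dep , minimal) = ∈cl-of-dependent indxP depyxP
    where
      x∈ : x ∈ (⁅ x ⁆ ∪ ⁅ y ⁆) - y
      x∈ = x∈p∧x≢y⇒x∈p-y (p⊆p∪q _ (x∈⁅x⁆ x)) x≢y
      indx = indep-contractAll⁻ P (minimal y (q⊆p∪q _ _ (x∈⁅x⁆ y)))
      indy = indep-contractAll⁻ P (minimal x (p⊆p∪q _ (x∈⁅x⁆ x)))
      indxP : Indep M (fromList (x ∷ P))
      indxP = indep-mono (∪-mono (⁅⁆-⊆ x∈) id) (proj₂ indx)
      P∩xy≡∅ : ∀ {p} → p ∈ˡ P → p ∉ ⁅ x ⁆ ∪ ⁅ y ⁆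
      P∩xy≡∅ p∈P h = [ (λ e → proj₁ indx p∈P (subst (_∈ _) (sym (x∈⁅y⁆⇒x≡y x e)) x∈))
                     , (λ e → proj₁ indy p∈P (subst (_∈ _) (sym (x∈⁅y⁆⇒x≡y y e))
                                (x∈p∧x≢y⇒x∈p-y (q⊆p∪q _ _ (x∈⁅x⁆ y)) (x≢y ∘ sym)))) ]′
                     (x∈p∪q⁻ _ _ h)
      depyxP : ¬ Indep M (⁅ y ⁆ ∪ fromList (x ∷ P))
      depyxP ind = dep (indep-contractAll⁺ P uP P∩xy≡∅ (indep-mono reorder ind))
        where
          reorder : (⁅ x ⁆ ∪ ⁅ y ⁆) ∪ fromList P ⊆ ⁅ y ⁆ ∪ (⁅ x ⁆ ∪ fromList P)
          reorder = ∪-least (∪-least (λ h → q⊆p∪q _ _ (p⊆p∪q _ h)) (p⊆p∪q _))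
                            (λ h → q⊆p∪q _ _ (q⊆p∪q _ _ h))

  parallel⇒SameClosure : ∀ P → Unique P → Parallel (contractAll P M) x y →
                         SameClosure M (fromList (y ∷ P)) (fromList (x ∷ P))
  parallel⇒SameClosure P uP par =
    sameClosure (⊆cl (parallel⇒∈cl P uP par)) (⊆cl (parallel⇒∈cl P uP (Parallel-sym {N = contractAll P M} par)))
    where
      ⊆cl : ∀ {u v} → u ∈cl fromList (v ∷ P) → ∀ {z} → z ∈ fromList (u ∷ P) → z ∈cl fromList (v ∷ P)
      ⊆cl u∈cl h = [ (λ e → subst (_∈cl _) (sym (x∈⁅y⁆⇒x≡y _ e)) u∈cl) , (λ z∈P → inj₁ (q⊆p∪q _ _ z∈P)) ]′
                     (x∈p∪q⁻ _ _ h)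

  parallel-intro : ∀ P → Unique P → x ≢ y → x ∉ˡ P → y ∉ˡ P →
                   Indep M (fromList (x ∷ P)) → Indep M (fromList (y ∷ P)) →
                   ¬ Indep M (⁅ x ⁆ ∪ fromList (y ∷ P)) → Parallel (contractAll P M) x y
  parallel-intro {x} {y} P uP x≢y x∉P y∉P indxP indyP depxyP = x≢y , dep , minimal
    where
      N = contractAll P M
      dep : ¬ Indep N (⁅ x ⁆ ∪ ⁅ y ⁆)
      dep ind = depxyP (indep-mono (⊆-reflexive (sym (∪-assoc ⁅ x ⁆ ⁅ y ⁆ _))) (proj₂ (indep-contractAll⁻ P ind)))
      singleton : ∀ {w} → w ∉ˡ P → Indep M (fromList (w ∷ P)) → Indep N ⁅ w ⁆
      singleton w∉P = indep-contractAll⁺ P uP (λ p∈P e → w∉P (subst (_∈ˡ P) (x∈⁅y⁆⇒x≡y _ e) p∈P))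
      others : ∀ {u v} → (⁅ u ⁆ ∪ ⁅ v ⁆) - u ⊆ ⁅ v ⁆
      others {u} h = [ (λ e → ⊥-elim (x∈p-y⇒x≢y h (x∈⁅y⁆⇒x≡y u e))) , id ]′ (x∈p∪q⁻ _ _ (p─q⊆p _ _ h))
      minimal : ∀ z → z ∈ ⁅ x ⁆ ∪ ⁅ y ⁆ → Indep N ((⁅ x ⁆ ∪ ⁅ y ⁆) - z)
      minimal z h with x∈p∪q⁻ ⁅ x ⁆ ⁅ y ⁆ h
      ... | inj₁ e rewrite x∈⁅y⁆⇒x≡y x e = indep-contractAll-mono P uP others (singleton y∉P indyP)
      ... | inj₂ e rewrite x∈⁅y⁆⇒x≡y y e | ∪-comm ⁅ x ⁆ ⁅ y ⁆ =
        indep-contractAll-mono P uP others (singleton x∉P indxP)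

-- Inversion counts

#below : Fin n → List (Fin n) → ℕ
#below x ys = length (filter (_<? x) ys)

crossInversions : List (Fin n) → List (Fin n) → ℕ
crossInversions []       ys = 0
crossInversions (x ∷ xs) ys = #below x ys + crossInversions xs ys

#below-++ : ∀ (x : Fin n) xs ys → #below x (xs ++ ys) ≡ #below x xs + #below x ys
#below-++ x xs ys = trans (cong length (filter-++ (_<? x) xs ys)) (length-++ (filter (_<? x) xs))

#below-zero : ∀ {m} (ys : List (Fin (suc m))) → #below zero ys ≡ 0
#below-zero []       = refl
#below-zero {m} (y ∷ ys) =
  trans (cong length (filter-reject (_<? zero {m}) {x = y} {xs = ys} (λ ()))) (#below-zero ys)

#below-suc : ∀ (x : Fin n) ys → #below (suc x) (map suc ys) ≡ #below x ys
#below-suc x []       = refl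
#below-suc x (y ∷ ys) with y <? x
... | yes y<x = trans (cong length (filter-accept (_<? suc x) {xs = map suc ys} (s≤s y<x)))
                  (trans (cong suc (#below-suc x ys))
                    (sym (cong length (filter-accept (_<? x) {xs = ys} y<x))))
... | no y≮x  = trans (cong length (filter-reject (_<? suc x) {xs = map suc ys} (λ h → y≮x (≤-pred h))))
                  (trans (#below-suc x ys)
                    (sym (cong length (filter-reject (_<? x) {xs = ys} y≮x))))

crossInversions-↭ : ∀ {xs xs′ : List (Fin n)} ys → xs ↭ xs′ → crossInversions xs ys ≡ crossInversions xs′ ys
crossInversions-↭ ys ↭.refl         = refl
crossInversions-↭ ys (↭.prep x p) = cong (#below x ys +_) (crossInversions-↭ ys p)
crossInversions-↭ ys (↭.swap x y p) =
  trans (cong (λ c → #below x ys + (#below y ys + c)) (crossInversions-↭ ys p))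
          (swap-summands (#below x ys) (#below y ys) _)
  where
    swap-summands : ∀ a b c → a + (b + c) ≡ b + (a + c)
    swap-summands = solve-∀
crossInversions-↭ ys (↭.trans p q) = trans (crossInversions-↭ ys p) (crossInversions-↭ ys q)

module FieldLemmas {c ℓ : Level} (F : Field c ℓ) where
  open Field F hiding (_+_; _-_) renaming (refl to ≈-refl; sym to ≈-sym; trans to ≈-trans)
  open import Algebra.Properties.Ring ring using (-‿involutive; -‿distribˡ-*; -‿distribʳ-*)
  open import Relation.Binary.Reasoning.Setoid setoid
  open CommutativeMonoidSolver *-commutativeMonoid using (solve; _⊜_; _⊕_)

  *-≉0 : ∀ {x y} → ¬ x ≈ 0# → ¬ y ≈ 0# → ¬ x * y ≈ 0#
  *-≉0 {x} {y} x≉0 y≉0 xy≈0 = y≉0 (begin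
    y                ≈⟨ ≈-sym (*-identityˡ y) ⟩
    1# * y           ≈⟨ *-congʳ (≈-sym (≈-trans (*-comm _ _) (⁻¹-inverse x x≉0))) ⟩
    (x ⁻¹ * x) * y   ≈⟨ *-assoc _ _ _ ⟩
    x ⁻¹ * (x * y)   ≈⟨ *-congˡ xy≈0 ⟩
    x ⁻¹ * 0#        ≈⟨ zeroʳ _ ⟩
    0#               ∎)

  ⁻¹≉0 : ∀ {x} → ¬ x ≈ 0# → ¬ x ⁻¹ ≈ 0#
  ⁻¹≉0 {x} x≉0 x⁻¹≈0 = 1≉0 (≈-trans (≈-sym (⁻¹-inverse x x≉0)) (≈-trans (*-congˡ x⁻¹≈0) (zeroʳ x)))

  ⁻¹-unique : ∀ {x y} → ¬ x ≈ 0# → x * y ≈ 1# → x ⁻¹ ≈ y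
  ⁻¹-unique {x} {y} x≉0 xy≈1 = begin
    x ⁻¹              ≈⟨ ≈-sym (*-identityʳ _) ⟩
    x ⁻¹ * 1#         ≈⟨ *-congˡ (≈-sym xy≈1) ⟩
    x ⁻¹ * (x * y)    ≈⟨ ≈-sym (*-assoc _ _ _) ⟩
    (x ⁻¹ * x) * y    ≈⟨ *-congʳ (≈-trans (*-comm _ _) (⁻¹-inverse x x≉0)) ⟩
    1# * y            ≈⟨ *-identityˡ y ⟩
    y                 ∎

  x≈x*[y*y⁻¹] : ∀ {x y} → ¬ y ≈ 0# → x ≈ x * (y * y ⁻¹)
  x≈x*[y*y⁻¹] {y = y} y≉0 = ≈-sym (≈-trans (*-congˡ (⁻¹-inverse y y≉0)) (*-identityʳ _))

  ratio-telescope : ∀ {b a s d} → ¬ b ≈ 0# → (a * (b * s ⁻¹)) * (d * b ⁻¹) ≈ a * (d * s ⁻¹)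
  ratio-telescope {b} {a} {s} {d} b≉0 = begin
    (a * (b * s ⁻¹)) * (d * b ⁻¹)   ≈⟨ solve 5 (λ a b s′ d b′ → (a ⊕ (b ⊕ s′)) ⊕ (d ⊕ b′) ⊜ (a ⊕ (d ⊕ s′)) ⊕ (b ⊕ b′))
                                           ≈-refl a b (s ⁻¹) d (b ⁻¹) ⟩
    (a * (d * s ⁻¹)) * (b * b ⁻¹)   ≈⟨ ≈-sym (x≈x*[y*y⁻¹] b≉0) ⟩
    a * (d * s ⁻¹)                  ∎

  ⁻¹-cong : ∀ {x y} → ¬ x ≈ 0# → x ≈ y → x ⁻¹ ≈ y ⁻¹
  ⁻¹-cong {x} {y} x≉0 x≈y = ⁻¹-unique x≉0 (≈-trans (*-congʳ x≈y) (⁻¹-inverse y (λ y≈0 → x≉0 (≈-trans x≈y y≈0))))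

  ratio-rescale : ∀ {s d a b x} → s * s ≈ 1# → ¬ d ≈ 0# → a ≈ s * b → x ≈ s * d → a * x ⁻¹ ≈ b * d ⁻¹
  ratio-rescale {s} {d} {a} {b} {x} s²≈1 d≉0 a≈sb x≈sd = begin
    a * x ⁻¹                ≈⟨ *-cong a≈sb (⁻¹-cong (λ x≈0 → sd≉0 (≈-trans (≈-sym x≈sd) x≈0)) x≈sd) ⟩
    (s * b) * (s * d) ⁻¹    ≈⟨ *-congˡ (⁻¹-unique sd≉0 sd*sd⁻¹≈1) ⟩
    (s * b) * (s * d ⁻¹)    ≈⟨ solve 3 (λ s b d′ → (s ⊕ b) ⊕ (s ⊕ d′) ⊜ (s ⊕ s) ⊕ (b ⊕ d′)) ≈-refl s b (d ⁻¹) ⟩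
    (s * s) * (b * d ⁻¹)    ≈⟨ *-congʳ s²≈1 ⟩
    1# * (b * d ⁻¹)         ≈⟨ *-identityˡ _ ⟩
    b * d ⁻¹                ∎
    where
      s≉0 : ¬ s ≈ 0#
      s≉0 s≈0 = 1≉0 (≈-trans (≈-sym s²≈1) (≈-trans (*-congʳ s≈0) (zeroˡ s)))
      sd≉0 : ¬ s * d ≈ 0#
      sd≉0 = *-≉0 s≉0 d≉0
      sd*sd⁻¹≈1 : (s * d) * (s * d ⁻¹) ≈ 1#
      sd*sd⁻¹≈1 = begin
        (s * d) * (s * d ⁻¹)    ≈⟨ solve 3 (λ s d d′ → (s ⊕ d) ⊕ (s ⊕ d′) ⊜ (s ⊕ s) ⊕ (d ⊕ d′)) ≈-refl s d (d ⁻¹) ⟩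
        (s * s) * (d * d ⁻¹)    ≈⟨ *-cong s²≈1 (⁻¹-inverse d d≉0) ⟩
        1# * 1#                 ≈⟨ *-identityˡ 1# ⟩
        1#                      ∎

  sgnPow-+ : ∀ i j → sgnPow F (i + j) ≈ sgnPow F i * sgnPow F j
  sgnPow-+ zero    j = ≈-sym (*-identityˡ _)
  sgnPow-+ (suc i) j = ≈-trans (-‿cong (sgnPow-+ i j)) (-‿distribˡ-* _ _)

  sgnPow-square : ∀ i → sgnPow F i * sgnPow F i ≈ 1#
  sgnPow-square zero    = *-identityˡ 1#
  sgnPow-square (suc i) = begin
    (- σ) * (- σ)    ≈⟨ ≈-sym (-‿distribˡ-* _ _) ⟩
    - (σ * - σ)      ≈⟨ -‿cong (≈-sym (-‿distribʳ-* _ _)) ⟩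
    - - (σ * σ)      ≈⟨ -‿involutive _ ⟩
    σ * σ            ≈⟨ sgnPow-square i ⟩
    1#               ∎
    where σ = sgnPow F i

  sgnPow≉0 : ∀ i → ¬ sgnPow F i ≈ 0#
  sgnPow≉0 i σ≈0 = 1≉0 (≈-trans (≈-sym (sgnPow-square i)) (≈-trans (*-congʳ σ≈0) (zeroˡ _)))

  inversions-++ : ∀ (xs ys : List (Fin n)) →
                  inversions F (xs ++ ys) ≡ inversions F xs + crossInversions xs ys + inversions F ys
  inversions-++ []       ys = ≡.refl
  inversions-++ (x ∷ xs) ys =
    ≡.trans (≡.cong₂ _+_ (#below-++ x xs ys) (inversions-++ xs ys))
            (regroup (#below x xs) (#below x ys) (inversions F xs) (crossInversions xs ys) (inversions F ys))
    where
      regroup : ∀ a b i c j → (a + b) + ((i + c) + j) ≡ ((a + i) + (b + c)) + j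
      regroup = solve-∀

  inversions-map-suc : ∀ (xs : List (Fin n)) → inversions F (map suc xs) ≡ inversions F xs
  inversions-map-suc []       = ≡.refl
  inversions-map-suc (x ∷ xs) = ≡.cong₂ _+_ (#below-suc x xs) (inversions-map-suc xs)

  inversions-elems : ∀ (p : Subset n) → inversions F (elems p) ≡ 0
  inversions-elems []ᵥ          = ≡.refl
  inversions-elems (true ∷ᵥ p)  =
    ≡.cong₂ _+_ (#below-zero (map suc (elems p))) (≡.trans (inversions-map-suc (elems p)) (inversions-elems p))
  inversions-elems (false ∷ᵥ p) = ≡.trans (inversions-map-suc (elems p)) (inversions-elems p)

  module _ {n : ℕ} (χ : Subset n → Carrier) where

    χo-unique : ∀ xs → Unique xs → χo F χ xs ≡ sgnPow F (inversions F xs) * χ (fromList xs)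
    χo-unique xs u rewrite dec-true (UniqueDec.unique? _≟_ xs) u = ≡.refl

    χo-nonunique : ∀ xs → ¬ Unique xs → χo F χ xs ≡ 0#
    χo-nonunique xs ¬u rewrite dec-false (UniqueDec.unique? _≟_ xs) ¬u = ≡.refl

    χo≉0 : ∀ xs → Unique xs → ¬ χ (fromList xs) ≈ 0# → ¬ χo F χ xs ≈ 0#
    χo≉0 xs u χ≉0 χo≈0 = *-≉0 (sgnPow≉0 (inversions F xs)) χ≉0 (≈-trans (reflexive (≡.sym (χo-unique xs u))) χo≈0)

    private
      prefix-normal : ∀ Z W → Unique (Z ++ W) →
        sgnPow F (inversions F Z) * χo F χ (Z ++ W)
          ≈ (sgnPow F (crossInversions Z W) * sgnPow F (inversions F W)) * χ (fromList (Z ++ W))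
      prefix-normal Z W u = begin
        σ i * χo F χ (Z ++ W)                  ≡⟨ ≡.cong (σ i *_) (χo-unique _ u) ⟩
        σ i * (σ (inversions F (Z ++ W)) * X)  ≡⟨ ≡.cong (λ k → σ i * (σ k * X)) (inversions-++ Z W) ⟩
        σ i * (σ (i + k + j) * X)              ≈⟨ *-congˡ (*-congʳ (≈-trans (sgnPow-+ (i + k) j)
                                                                       (*-congʳ (sgnPow-+ i k)))) ⟩
        σ i * (((σ i * σ k) * σ j) * X)        ≈⟨ solve 4 (λ I K J X → I ⊕ (((I ⊕ K) ⊕ J) ⊕ X) ⊜ (I ⊕ I) ⊕ ((K ⊕ J) ⊕ X))
                                                    ≈-refl (σ i) (σ k) (σ j) X ⟩
        (σ i * σ i) * ((σ k * σ j) * X)        ≈⟨ *-congʳ (sgnPow-square i) ⟩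
        1# * ((σ k * σ j) * X)                 ≈⟨ *-identityˡ _ ⟩
        (σ k * σ j) * X                        ∎
        where
          σ = sgnPow F
          i = inversions F Z
          k = crossInversions Z W
          j = inversions F W
          X = χ (fromList (Z ++ W))

    χo-↭-prefix : ∀ {Z₁ Z₂} W → Z₁ ↭ Z₂ →
      sgnPow F (inversions F Z₁) * χo F χ (Z₁ ++ W) ≈ sgnPow F (inversions F Z₂) * χo F χ (Z₂ ++ W)
    χo-↭-prefix {Z₁} {Z₂} W Z₁↭Z₂ = by-uniqueness (UniqueDec.unique? _≟_ (Z₁ ++ W))
      where
        Z₁W↭Z₂W = ++⁺ʳ W Z₁↭Z₂
        vanishes : ∀ Z → ¬ Unique (Z ++ W) → sgnPow F (inversions F Z) * χo F χ (Z ++ W) ≈ 0#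
        vanishes Z ¬u = ≈-trans (*-congˡ (reflexive (χo-nonunique _ ¬u))) (zeroʳ _)
        by-uniqueness : Dec (Unique (Z₁ ++ W)) →
          sgnPow F (inversions F Z₁) * χo F χ (Z₁ ++ W) ≈ sgnPow F (inversions F Z₂) * χo F χ (Z₂ ++ W)
        by-uniqueness (no ¬u) =
          ≈-trans (vanishes Z₁ ¬u) (≈-sym (vanishes Z₂ (λ u → ¬u (Unique-resp-↭ (↭-sym Z₁W↭Z₂W) u))))
        by-uniqueness (yes u) = begin
          sgnPow F (inversions F Z₁) * χo F χ (Z₁ ++ W)
            ≈⟨ prefix-normal Z₁ W u ⟩
          (sgnPow F (crossInversions Z₁ W) * sgnPow F (inversions F W)) * χ (fromList (Z₁ ++ W))
            ≡⟨ ≡.cong₂ (λ k S → (sgnPow F k * sgnPow F (inversions F W)) * χ S)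
                       (crossInversions-↭ W Z₁↭Z₂) (fromList-↭ Z₁W↭Z₂W) ⟩
          (sgnPow F (crossInversions Z₂ W) * sgnPow F (inversions F W)) * χ (fromList (Z₂ ++ W))
            ≈⟨ prefix-normal Z₂ W (Unique-resp-↭ Z₁W↭Z₂W u) ⟨
          sgnPow F (inversions F Z₂) * χo F χ (Z₂ ++ W) ∎

    χo-elems-prefix : ∀ {p Z} W → elems p ↭ Z →
                      χo F χ (elems p ++ W) ≈ sgnPow F (inversions F Z) * χo F χ (Z ++ W)
    χo-elems-prefix {p} {Z} W p↭Z = begin
      χo F χ (elems p ++ W)
        ≈⟨ *-identityˡ _ ⟨
      sgnPow F 0 * χo F χ (elems p ++ W)
        ≡⟨ ≡.cong (λ k → sgnPow F k * χo F χ (elems p ++ W)) (inversions-elems p) ⟨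
      sgnPow F (inversions F (elems p)) * χo F χ (elems p ++ W)
        ≈⟨ χo-↭-prefix W p↭Z ⟩
      sgnPow F (inversions F Z) * χo F χ (Z ++ W) ∎

module ResidueSteps {c ℓ : Level} (F : Field c ℓ) where
  open Field F hiding (_+_; _-_) renaming (refl to ≈-refl; sym to ≈-sym; trans to ≈-trans)
  open FieldLemmas F
  open import Relation.Binary.Reasoning.Setoid setoid

  contractAllχ : List (Fin n) → (Subset n → Carrier) → Subset n → Carrier
  contractAllχ []      χ = χ
  contractAllχ (x ∷ P) χ = contractχ F x (contractAllχ P χ)

  χo-contractAllχ : ∀ (χ : Subset n → Carrier) P Z → χo F (contractAllχ P χ) Z ≈ χo F χ (Z ++ P)
  χo-contractAllχ χ []      Z = reflexive (≡.cong (χo F χ) (≡.sym (++-identityʳ Z)))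
  χo-contractAllχ χ (x ∷ P) Z = by-uniqueness (UniqueDec.unique? _≟_ Z)
    where
      by-uniqueness : Dec (Unique Z) → χo F (contractAllχ (x ∷ P) χ) Z ≈ χo F χ (Z ++ x ∷ P)
      by-uniqueness (no ¬u) = ≈-trans (reflexive (χo-nonunique (contractAllχ (x ∷ P) χ) Z ¬u))
                                    (≈-sym (reflexive (χo-nonunique χ _ (λ u → ¬u (Unique-++⁻ˡ Z u)))))
      by-uniqueness (yes u) = begin
        χo F (contractAllχ (x ∷ P) χ) Z             ≡⟨ χo-unique (contractAllχ (x ∷ P) χ) Z u ⟩
        σ * χo F (contractAllχ P χ) (Ẑ ++ [ x ])    ≈⟨ *-congˡ (χo-contractAllχ χ P (Ẑ ++ [ x ])) ⟩
        σ * χo F χ ((Ẑ ++ [ x ]) ++ P)              ≡⟨ ≡.cong (λ L → σ * χo F χ L) (++-assoc Ẑ [ x ] P) ⟩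
        σ * χo F χ (Ẑ ++ x ∷ P)                     ≈⟨ *-congˡ (χo-elems-prefix χ (x ∷ P) (elems-fromList-↭ u)) ⟩
        σ * (σ * χo F χ (Z ++ x ∷ P))               ≈⟨ *-assoc _ _ _ ⟨
        (σ * σ) * χo F χ (Z ++ x ∷ P)               ≈⟨ *-congʳ (sgnPow-square (inversions F Z)) ⟩
        1# * χo F χ (Z ++ x ∷ P)                    ≈⟨ *-identityˡ _ ⟩
        χo F χ (Z ++ x ∷ P)                         ∎
        where
          σ = sgnPow F (inversions F Z)
          Ẑ = elems (fromList Z)

  χo-contractAllχ-sorted : ∀ (χ : Subset n → Carrier) P {T} w → Unique T →
    χo F (contractAllχ P χ) (elems (fromList T) ++ [ w ])
      ≈ sgnPow F (inversions F (reverse T)) * χo F χ (T ʳ++ w ∷ P)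
  χo-contractAllχ-sorted χ P {T} w u = begin
    χo F (contractAllχ P χ) (T̂ ++ [ w ])  ≈⟨ χo-contractAllχ χ P (T̂ ++ [ w ]) ⟩
    χo F χ ((T̂ ++ [ w ]) ++ P)            ≡⟨ ≡.cong (χo F χ) (++-assoc T̂ [ w ] P) ⟩
    χo F χ (T̂ ++ w ∷ P)                   ≈⟨ χo-elems-prefix χ (w ∷ P) (↭-trans (elems-fromList-↭ u) (↭-sym (↭-reverse T))) ⟩
    σ * χo F χ (reverse T ++ w ∷ P)       ≡⟨ ≡.cong (λ L → σ * χo F χ L) (ʳ++-defn T) ⟨
    σ * χo F χ (T ʳ++ w ∷ P)              ∎
    where
      σ = sgnPow F (inversions F (reverse T))
      T̂ = elems (fromList T)

  parallelRatio : (Subset n → Carrier) → Subset n → Fin n → Fin n → Carrier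
  parallelRatio ψ S x y = χo F ψ (elems (S - y) ++ [ x ]) * χo F ψ (elems (S - y) ++ [ y ]) ⁻¹

  parallelRatio-contractAllχ : ∀ (χ : Subset n → Carrier) P {T x j} → Unique T → j ∉ fromList T →
    ¬ χo F χ (T ʳ++ j ∷ P) ≈ 0# →
    parallelRatio (contractAllχ P χ) (fromList (j ∷ T)) x j ≈ χo F χ (T ʳ++ x ∷ P) * χo F χ (T ʳ++ j ∷ P) ⁻¹
  parallelRatio-contractAllχ χ P {T} {x} {j} uT j∉T den≉0 = ≈-trans
    (reflexive (≡.cong (λ S → χo F ψ (elems S ++ [ x ]) * χo F ψ (elems S ++ [ j ]) ⁻¹) ([⁅x⁆∪p]-x≡p j∉T)))
    (ratio-rescale (sgnPow-square (inversions F (reverse T))) den≉0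
      (χo-contractAllχ-sorted χ P x uT) (χo-contractAllχ-sorted χ P j uT))
    where ψ = contractAllχ P χ

  data StepCase (N : RawMatroid n) (x : Fin n) (S : Subset n) (ψ : Subset n → Carrier) (a : Carrier) :
                Carrier × Subset n → Set c where
    contains : x ∈ S → StepCase N x S ψ a (a , S - x)
    parallel : ∀ {y} → x ∉ S → y ∈ S → Parallel N x y → StepCase N x S ψ a (a * parallelRatio ψ S x y , S - y)
    vanishes : x ∉ S → (∀ {y} → y ∈ S → ¬ Parallel N x y) → StepCase N x S ψ a (0# , S)

  stepCase : ∀ N x S ψ a → StepCase {n} N x S ψ a (pStep F N ψ x (a , S))
  stepCase N x S ψ a with x ∈? S
  ... | yes x∈S = contains x∈S
  ... | no x∉S with any? (λ y → (y ∈? S) ×-dec parallel? N x y)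
  ...   | yes (y , y∈S , x∥y) = parallel x∉S y∈S x∥y
  ...   | no ¬∃y = vanishes x∉S (λ y∈S x∥y → ¬∃y (_ , y∈S , x∥y))

  residueGo-zero : ∀ (N : RawMatroid n) ψ R {a} S → a ≈ 0# → residueGo F N ψ R (a , S) ≈ 0#
  residueGo-zero N ψ []      S a≈0 = a≈0
  residueGo-zero N ψ (x ∷ R) {a} S a≈0 = step (stepCase N x S ψ a)
    where
      step : ∀ {out} → StepCase N x S ψ a out → residueGo F (contract x N) (contractχ F x ψ) R out ≈ 0#
      step (contains _)     = residueGo-zero _ _ R _ a≈0
      step (parallel _ _ _) = residueGo-zero _ _ R _ (≈-trans (*-congʳ a≈0) (zeroˡ _))
      step (vanishes _ _)   = residueGo-zero _ _ R _ ≈-refl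

module ResidueComputation {c ℓ : Level} (F : Field c ℓ) {n : ℕ} {M : RawMatroid n} (isM : IsMatroid M)
  (χ : Subset n → Field.Carrier F) (χ≉0 : ∀ I → Indep M I → ¬ Field._≈_ F (χ I) (Field.0# F)) where
  open Field F hiding (_+_; _-_) renaming (refl to ≈-refl; sym to ≈-sym; trans to ≈-trans)
  open FieldLemmas F
  open ResidueSteps F
  open MatroidClosure isM
  open Contraction isM
  open import Relation.Binary.Reasoning.Setoid setoid

  private variable
    z : Fin n

  -- The processed elements P of I^σ are stored most recent first, and the remaining ones R in
  -- reverse order, so that I^σ = R ʳ++ P.
  contractedResidue : List (Fin n) → List (Fin n) → Carrier → Subset n → Carrier
  contractedResidue P R a S = residueGo F (contractAll P M) (contractAllχ P χ) R (a , S)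

  χo-independent≉0 : Unique xs → Indep M (fromList xs) → ¬ χo F χ xs ≈ 0#
  χo-independent≉0 u ind = χo≉0 χ _ u (χ≉0 _ ind)

  -- j is the only element of j ∷ T in cl (j ∷ P), and x is either j or parallel to j in M/P.
  matchedStep : ∀ P {x j} T {a} → x ∉ˡ P → Indep M (fromList (x ∷ P)) →
    Unique (T ʳ++ j ∷ P) → Indep M (fromList (T ʳ++ j ∷ P)) →
    SameClosure M (fromList (j ∷ P)) (fromList (x ∷ P)) →
    ∀ {out} → StepCase (contractAll P M) x (fromList (j ∷ T)) (contractAllχ P χ) a out →
    proj₂ out ≡ fromList T × proj₁ out ≈ a * (χo F χ (T ʳ++ x ∷ P) * χo F χ (T ʳ++ j ∷ P) ⁻¹)
  matchedStep P {x} {j} T {a} x∉P indxP uK indK jP~xP = step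
    where
      uT = proj₁ (Unique-ʳ++⁻ T uK)
      ujP = proj₁ (proj₂ (Unique-ʳ++⁻ T uK))
      uP = AllPairs.tail ujP
      S = fromList (j ∷ T)

      j∉T : j ∉ fromList T
      j∉T h = proj₂ (proj₂ (Unique-ʳ++⁻ T uK)) (∈-fromList⁻ h , here ≡.refl)

      x∈cl : x ∈cl fromList (j ∷ P)
      x∈cl = proj₂ (jP~xP x) (inj₁ (p⊆p∪q _ (x∈⁅x⁆ x)))

      x∥j : x ∉ S → Parallel (contractAll P M) x j
      x∥j x∉S = parallel-intro P uP x≢j x∉P (Unique[x∷xs]⇒x∉xs ujP) indxP (indep-ʳ++⁻ʳ T indK)
                  (λ ind → ∉cl-of-independent id ind x∉jP x∈cl)
        where
          x≢j : x ≢ j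
          x≢j ≡.refl = x∉S (p⊆p∪q _ (x∈⁅x⁆ j))
          x∉jP : x ∉ fromList (j ∷ P)
          x∉jP h = [ (λ e → x≢j (x∈⁅y⁆⇒x≡y j e)) , (λ h′ → x∉P (∈-fromList⁻ h′)) ]′ (x∈p∪q⁻ _ _ h)

      step : ∀ {out} → StepCase (contractAll P M) x S (contractAllχ P χ) a out →
             proj₂ out ≡ fromList T × proj₁ out ≈ a * (χo F χ (T ʳ++ x ∷ P) * χo F χ (T ʳ++ j ∷ P) ⁻¹)
      step (contains x∈S) with ≡.refl ← ∈cl-ʳ++-head T P uK indK x∈S x∈cl =
        [⁅x⁆∪p]-x≡p j∉T , x≈x*[y*y⁻¹] (χo-independent≉0 uK indK)
      step (parallel x∉S y∈S x∥y)
        with ≡.refl ← ∈cl-ʳ++-head T P uK indK y∈S (proj₂ (jP~xP _) (parallel⇒∈cl P uP x∥y)) =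
        [⁅x⁆∪p]-x≡p j∉T , *-congˡ (parallelRatio-contractAllχ χ P uT j∉T (χo-independent≉0 uK indK))
      step (vanishes x∉S ¬∥) = ⊥-elim (¬∥ (p⊆p∪q _ (x∈⁅x⁆ j)) (x∥j x∉S))

  contractedResidue-flag : ∀ R P T a →
    Unique (R ʳ++ P) → Indep M (fromList (R ʳ++ P)) →
    Unique (T ʳ++ P) → Indep M (fromList (T ʳ++ P)) →
    length T ≡ length R → SameFlag M (T ʳ++ P) (R ʳ++ P) →
    contractedResidue P R a (fromList T) ≈ a * (χo F χ (R ʳ++ P) * χo F χ (T ʳ++ P) ⁻¹)
  contractedResidue-flag []      P []      a _  _    uK indK _   _    = x≈x*[y*y⁻¹] (χo-independent≉0 uK indK)
  contractedResidue-flag (x ∷ R) P (j ∷ T) a uL indL uK indK len flag = begin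
    contractedResidue (x ∷ P) R a′ S′                     ≡⟨ ≡.cong (contractedResidue (x ∷ P) R a′) S′≡T ⟩
    contractedResidue (x ∷ P) R a′ (fromList T)           ≈⟨ contractedResidue-flag R (x ∷ P) T a′ uL indL uK′ indK′
                                                                (ℕ.suc-injective len) flag′ ⟩
    a′ * (χo F χ (R ʳ++ x ∷ P) * χo F χ (T ʳ++ x ∷ P) ⁻¹)  ≈⟨ *-congʳ a′≈ ⟩
    (a * (χo F χ (T ʳ++ x ∷ P) * χo F χ (T ʳ++ j ∷ P) ⁻¹)) * (χo F χ (R ʳ++ x ∷ P) * χo F χ (T ʳ++ x ∷ P) ⁻¹)
                                                          ≈⟨ ratio-telescope (χo-independent≉0 uK′ indK′) ⟩
    a * (χo F χ (R ʳ++ x ∷ P) * χo F χ (T ʳ++ j ∷ P) ⁻¹)  ∎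
    where
      uxP = proj₁ (proj₂ (Unique-ʳ++⁻ R uL))
      indxP = indep-ʳ++⁻ʳ R indL
      jP~xP : SameClosure M (fromList (j ∷ P)) (fromList (x ∷ P))
      jP~xP = SameFlag-head (SameFlag-ʳ++⁻ T R (ℕ.suc-injective len) flag)

      out = pStep F (contractAll P M) (contractAllχ P χ) x (a , fromList (j ∷ T))
      a′ = proj₁ out
      S′ = proj₂ out
      matched = matchedStep P T (Unique[x∷xs]⇒x∉xs uxP) indxP uK indK jP~xP (stepCase _ x _ _ a)
      S′≡T = proj₁ matched
      a′≈ = proj₂ matched

      replaced = ʳ++-replace-head T P uK indK uxP indxP jP~xP
      uK′ = proj₁ replaced
      indK′ = proj₂ replaced
      flag′ : SameFlag M (T ʳ++ x ∷ P) (R ʳ++ x ∷ P)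
      flag′ = SameFlag-trans (SameFlag-ʳ++ T (SameClosure-sym jP~xP ∷ SameFlag-refl)) flag

  nonvanishingStep : ∀ P {x S a} R → Unique P →
    ∀ {out} → StepCase (contractAll P M) x S (contractAllχ P χ) a out →
    ¬ contractedResidue (x ∷ P) R (proj₁ out) (proj₂ out) ≈ 0# →
    ∃ λ z → z ∈ S × proj₂ out ≡ S - z × SameClosure M (fromList (z ∷ P)) (fromList (x ∷ P))
  nonvanishingStep P R uP (contains x∈S)        _ = _ , x∈S , ≡.refl , SameClosure-refl
  nonvanishingStep P R uP (parallel _ y∈S x∥y)  _ = _ , y∈S , ≡.refl , parallel⇒SameClosure P uP x∥y
  nonvanishingStep P R uP (vanishes _ _)        ≉0 = ⊥-elim (≉0 (residueGo-zero _ _ R _ ≈-refl))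

  contractedResidue≉0⇒flag : ∀ R P a S → Unique (R ʳ++ P) → ∣ S ∣ ≡ length R → ¬ contractedResidue P R a S ≈ 0# →
    ∃ λ T → fromList T ≡ S × Unique T × SameFlag M (T ʳ++ P) (R ʳ++ P)
  contractedResidue≉0⇒flag []      P a S _  ∣S∣≡0 _ = [] , ≡.sym (∣p∣≡0⇒p≡⊥ ∣S∣≡0) , [] , SameFlag-refl
  contractedResidue≉0⇒flag (x ∷ R) P a S uL ∣S∣≡ ≉0 =
    extend (nonvanishingStep P R (AllPairs.tail (proj₁ (proj₂ (Unique-ʳ++⁻ R uL)))) (stepCase _ x S _ a) ≉0)
    where
      out = pStep F (contractAll P M) (contractAllχ P χ) x (a , S)
      extend : ∃ (λ z → z ∈ S × proj₂ out ≡ S - z × SameClosure M (fromList (z ∷ P)) (fromList (x ∷ P))) →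
               ∃ λ T → fromList T ≡ S × Unique T × SameFlag M (T ʳ++ P) ((x ∷ R) ʳ++ P)
      extend (z , z∈S , S′≡S-z , zP~xP)
        with contractedResidue≉0⇒flag R (x ∷ P) (proj₁ out) (S - z) uL (ℕ.suc-injective (≡.trans (suc∣p-x∣ z∈S) ∣S∣≡))
               (≡.subst (λ S′ → ¬ contractedResidue (x ∷ P) R (proj₁ out) S′ ≈ 0#) S′≡S-z ≉0)
      ... | T , T≡S-z , uT , flag =
        z ∷ T , ≡.trans (≡.cong (⁅ z ⁆ ∪_) T≡S-z) (⁅x⁆∪[p-x]≡p z∈S) ,
        Unique-∷ (λ z∈T → x∈p-y⇒x≢y (≡.subst (z ∈_) T≡S-z (∈-fromList⁺ z∈T)) ≡.refl) uT ,
        SameFlag-trans (SameFlag-ʳ++ T (zP~xP ∷ SameFlag-refl)) flag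

  iteratedResidue-flag : ∀ {L K} → Unique L → Indep M (fromList L) → Unique K → Indep M (fromList K) →
    length K ≡ length L → SameFlag M K L → iteratedResidue F M χ L (fromList K) ≈ χo F χ L * χo F χ K ⁻¹
  iteratedResidue-flag {L} {K} uL indL uK indK len flag = begin
    residueGo F M χ (reverse L) (1# , fromList K)
      ≡⟨ ≡.cong (λ S → residueGo F M χ (reverse L) (1# , S)) (fromList-↭ (↭-sym (↭-reverse K))) ⟩
    contractedResidue [] (reverse L) 1# (fromList (reverse K))
      ≈⟨ contractedResidue-flag (reverse L) [] (reverse K) 1#
           (reverse² Unique uL) (reverse² (Indep M ∘ fromList) {L} indL)
           (reverse² Unique uK) (reverse² (Indep M ∘ fromList) {K} indK)
           (≡.trans (length-reverse K) (≡.trans len (≡.sym (length-reverse L))))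
           (≡.subst₂ (SameFlag M) (≡.sym (reverse-involutive K)) (≡.sym (reverse-involutive L)) flag) ⟩
    1# * (χo F χ (reverse (reverse L)) * χo F χ (reverse (reverse K)) ⁻¹)
      ≡⟨ ≡.cong₂ (λ L′ K′ → 1# * (χo F χ L′ * χo F χ K′ ⁻¹)) (reverse-involutive L) (reverse-involutive K) ⟩
    1# * (χo F χ L * χo F χ K ⁻¹)
      ≈⟨ *-identityˡ _ ⟩
    χo F χ L * χo F χ K ⁻¹ ∎
    where
      reverse² : ∀ (P : List (Fin n) → Set) {xs} → P xs → P (reverse (reverse xs))
      reverse² P {xs} = ≡.subst P (≡.sym (reverse-involutive xs))

  iteratedResidue≉0⇒flag : ∀ {L S} → Unique L → ∣ S ∣ ≡ length L → ¬ iteratedResidue F M χ L S ≈ 0# →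
    ∃ λ K → fromList K ≡ S × Unique K × SameFlag M K L
  iteratedResidue≉0⇒flag {L} {S} uL ∣S∣≡ ≉0
    with contractedResidue≉0⇒flag (reverse L) [] 1# S (≡.subst Unique (≡.sym (reverse-involutive L)) uL)
           (≡.trans ∣S∣≡ (≡.sym (length-reverse L))) ≉0
  ... | T , T≡S , uT , flag =
    reverse T , ≡.trans (fromList-↭ (↭-reverse T)) T≡S , Unique-resp-↭ (↭-sym (↭-reverse T)) uT ,
    ≡.subst (SameFlag M (reverse T)) (reverse-involutive L) flag

-- Listings of strictly increasing vectors

∈-vecSet⁺ : ∀ (v : Vec (Fin n) ℓ) i → lookup v i ∈ vecSet v
∈-vecSet⁺ (x ∷ᵥ v) zero    = p⊆p∪q (vecSet v) (x∈⁅x⁆ x)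
∈-vecSet⁺ (x ∷ᵥ v) (suc i) = q⊆p∪q ⁅ x ⁆ (vecSet v) (∈-vecSet⁺ v i)

∈-vecSet⁻ : ∀ (v : Vec (Fin n) ℓ) {z} → z ∈ vecSet v → ∃ λ i → lookup v i ≡ z
∈-vecSet⁻ []ᵥ       h = ⊥-elim (∉⊥ h)
∈-vecSet⁻ (x ∷ᵥ v) h =
  [ (λ e → zero , sym (x∈⁅y⁆⇒x≡y x e)) , (λ h′ → let i , e = ∈-vecSet⁻ v h′ in suc i , e) ]′
    (x∈p∪q⁻ ⁅ x ⁆ (vecSet v) h)

lookup-injective : ∀ (v : Vec (Fin n) ℓ) → StrictlyIncreasing v → ∀ {i j} → lookup v i ≡ lookup v j → i ≡ j
lookup-injective v v↑ {i} {j} e with <-cmp i j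
... | tri< i<j _ _   = ⊥-elim (Fin.<-irrefl e (v↑ i j i<j))
... | tri≈ _ i≡j _   = i≡j
... | tri> _ _ j<i   = ⊥-elim (Fin.<-irrefl (sym e) (v↑ j i j<i))

Unique⇒lookup-injective : ∀ {A : Set} (xs : List A) → Unique xs → ∀ {i j} → List.lookup xs i ≡ List.lookup xs j → i ≡ j
Unique⇒lookup-injective (x ∷ xs) u          {zero}  {zero}  _ = refl
Unique⇒lookup-injective (x ∷ xs) (x∉xs ∷ _) {zero}  {suc j} e =
  ⊥-elim (All¬⇒¬Any x∉xs (subst (_∈ˡ xs) (sym e) (∈-lookup j)))
Unique⇒lookup-injective (x ∷ xs) (x∉xs ∷ _) {suc i} {zero}  e =
  ⊥-elim (All¬⇒¬Any x∉xs (subst (_∈ˡ xs) e (∈-lookup i)))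
Unique⇒lookup-injective (x ∷ xs) (_ ∷ u)    {suc i} {suc j} e = cong suc (Unique⇒lookup-injective xs u e)

tabulate-injective : ∀ {A : Set} {m} {f g : Fin m → A} → tabulate f ≡ tabulate g → ∀ i → f i ≡ g i
tabulate-injective {m = suc m} e zero    = ∷-injectiveˡ e
tabulate-injective {m = suc m} e (suc i) = tabulate-injective (∷-injectiveʳ e) i

length-listing : ∀ (v : Vec (Fin n) ℓ) σ → length (listing v σ) ≡ ℓ
length-listing v σ = length-tabulate _

fromList-listing : ∀ (v : Vec (Fin n) ℓ) σ → fromList (listing v σ) ≡ vecSet v
fromList-listing v σ = ⊆-antisym ⊆vecSet vecSet⊆
  where
    ⊆vecSet : fromList (listing v σ) ⊆ vecSet v
    ⊆vecSet h with ∈-tabulate⁻ {f = λ k → lookup v (σ ⟨$⟩ʳ k)} (∈-fromList⁻ h)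
    ... | k , refl = ∈-vecSet⁺ v (σ ⟨$⟩ʳ k)
    vecSet⊆ : vecSet v ⊆ fromList (listing v σ)
    vecSet⊆ h with ∈-vecSet⁻ v h
    ... | i , refl = ∈-fromList⁺ (subst (λ k → lookup v k ∈ˡ listing v σ) (inverseʳ σ)
                                   (∈-tabulate⁺ {f = λ k → lookup v (σ ⟨$⟩ʳ k)} (σ ⟨$⟩ˡ i)))

module _ (v : Vec (Fin n) ℓ) (v↑ : StrictlyIncreasing v) where

  listing-unique : ∀ σ → Unique (listing v σ)
  listing-unique σ =
    tabulate⁺ λ e → trans (sym (inverseˡ σ)) (trans (cong (σ ⟨$⟩ˡ_) (lookup-injective v v↑ e)) (inverseˡ σ))

  ∣vecSet∣ : ∣ vecSet v ∣ ≡ ℓ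
  ∣vecSet∣ = trans (cong ∣_∣ (sym (fromList-listing v Permutation.id)))
               (trans (∣fromList∣ (listing-unique Permutation.id)) (length-listing v Permutation.id))

  listing-injective : ∀ {τ τ′} → listing v τ ≡ listing v τ′ → ∀ i → τ ⟨$⟩ʳ i ≡ τ′ ⟨$⟩ʳ i
  listing-injective e i = lookup-injective v v↑ (tabulate-injective e i)

  listing-surjective : ∀ {K} → Unique K → fromList K ≡ vecSet v → ∃ λ τ → listing v τ ≡ K
  listing-surjective {K} uK K≡v = surject (trans (sym (∣fromList∣ uK)) (trans (cong ∣_∣ K≡v) ∣vecSet∣))
    where
      surject : length K ≡ ℓ → ∃ λ τ → listing v τ ≡ K
      surject refl = permutation to from from∘to to∘from , trans (tabulate-cong lookup-to) (tabulate-lookup K)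
        where
          position : ∀ k → ∃ λ i → lookup v i ≡ List.lookup K k
          position k = ∈-vecSet⁻ v (subst (List.lookup K k ∈_) K≡v (∈-fromList⁺ (∈-lookup {xs = K} k)))
          to : Fin (length K) → Fin (length K)
          to k = proj₁ (position k)
          lookup-to : ∀ k → lookup v (to k) ≡ List.lookup K k
          lookup-to k = proj₂ (position k)
          index-of : ∀ i → lookup v i ∈ˡ K
          index-of i = ∈-fromList⁻ (subst (lookup v i ∈_) (sym K≡v) (∈-vecSet⁺ v i))
          from : Fin (length K) → Fin (length K)
          from i = index (index-of i)
          lookup-from : ∀ i → List.lookup K (from i) ≡ lookup v i
          lookup-from i = sym (lookup-index (index-of i))
          from∘to : ∀ i → to (from i) ≡ i
          from∘to i = lookup-injective v v↑ (trans (lookup-to (from i)) (lookup-from i))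
          to∘from : ∀ k → from (to k) ≡ k
          to∘from k = Unique⇒lookup-injective K uK (trans (lookup-from (to k)) (lookup-to k))

module OrderedSetResidues {c ℓ′ : Level} (F : Field c ℓ′) {n : ℕ} {M : RawMatroid n} (isM : IsMatroid M)
  (χ : Subset n → Field.Carrier F) (χ≉0 : ∀ I → Indep M I → ¬ Field._≈_ F (χ I) (Field.0# F)) where
  open Field F hiding (_+_; _-_) renaming (refl to ≈-refl; sym to ≈-sym; trans to ≈-trans)
  open FieldLemmas F using (*-≉0; ⁻¹≉0)
  open MatroidClosure isM using (SameFlag⇒≡; SameFlag-refl; SameFlag-sym; SameFlag-trans)
  open ResidueComputation F isM χ χ≉0

  indep-listing : ∀ {ℓ} (v : Vec (Fin n) ℓ) → Indep M (vecSet v) → ∀ τ → Indep M (fromList (listing v τ))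
  indep-listing v ind τ = ≡.subst (Indep M) (≡.sym (fromList-listing v τ)) ind

  module FlagResidues {ℓ} (I J : Vec (Fin n) ℓ) (I↑ : StrictlyIncreasing I) (J↑ : StrictlyIncreasing J)
           (indI : Indep M (vecSet I)) (indJ : Indep M (vecSet J)) (σ : Permutation′ ℓ) where

    listingResidue-flag : ∀ τ → SameFlag M (listing J τ) (listing I σ) →
      iteratedResidue F M χ (listing I σ) (vecSet J) ≈ χo F χ (listing I σ) * χo F χ (listing J τ) ⁻¹
    listingResidue-flag τ flag =
      ≡.subst (λ S → iteratedResidue F M χ (listing I σ) S ≈ χo F χ (listing I σ) * χo F χ (listing J τ) ⁻¹)
        (fromList-listing J τ)
        (iteratedResidue-flag (listing-unique I I↑ σ) (indep-listing I indI σ) (listing-unique J J↑ τ)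
          (indep-listing J indJ τ) (≡.trans (length-listing J τ) (≡.sym (length-listing I σ))) flag)

    listingResidue-flag≉0 : ∀ τ → SameFlag M (listing J τ) (listing I σ) →
      ¬ iteratedResidue F M χ (listing I σ) (vecSet J) ≈ 0#
    listingResidue-flag≉0 τ flag ≈0 =
      *-≉0 (χo-independent≉0 (listing-unique I I↑ σ) (indep-listing I indI σ))
           (⁻¹≉0 (χo-independent≉0 (listing-unique J J↑ τ) (indep-listing J indJ τ)))
           (≈-trans (≈-sym (listingResidue-flag τ flag)) ≈0)

    listingResidue≉0⇒flag : ¬ iteratedResidue F M χ (listing I σ) (vecSet J) ≈ 0# →
      ∃ λ τ → SameFlag M (listing J τ) (listing I σ)
    listingResidue≉0⇒flag ≉0
      with iteratedResidue≉0⇒flag (listing-unique I I↑ σ) (≡.trans (∣vecSet∣ J J↑) (≡.sym (length-listing I σ))) ≉0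
    ... | K , K≡J , uK , flag with listing-surjective J J↑ uK K≡J
    ... | τ , ≡.refl = τ , flag

    listing-flag-unique : ∀ τ τ′ → SameFlag M (listing J τ) (listing I σ) →
                          SameFlag M (listing J τ′) (listing I σ) → ∀ i → τ′ ⟨$⟩ʳ i ≡ τ ⟨$⟩ʳ i
    listing-flag-unique τ τ′ flag flag′ = listing-injective J J↑ {τ′} {τ}
      (SameFlag⇒≡ indJ (⊆-reflexive (fromList-listing J τ′)) (⊆-reflexive (fromList-listing J τ))
         (listing-unique J J↑ τ′) (listing-unique J J↑ τ) (SameFlag-trans flag′ (SameFlag-sym flag)))

  listingResidue-self : ∀ {ℓ} (I : Vec (Fin n) ℓ) → StrictlyIncreasing I → Indep M (vecSet I) →
                 ∀ σ → iteratedResidue F M χ (listing I σ) (vecSet I) ≈ 1#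
  listingResidue-self I I↑ indI σ = ≈-trans (FlagResidues.listingResidue-flag I I I↑ I↑ indI indI σ σ SameFlag-refl)
                                 (⁻¹-inverse _ (χo-independent≉0 (listing-unique I I↑ σ) (indep-listing I indI σ)))

proposition2p8 : ∀ {c ℓ′ : Level} (F : Field c ℓ′) {n : ℕ}
    (β : Fin n → Fin n → Field.Carrier F) (M : RawMatroid n)
    (χ : Subset n → Field.Carrier F) →
    IsMatroid M → IsChiAlgebra F β M χ →
    ∀ {ℓ : ℕ} (I J : Vec (Fin n) ℓ) →
    StrictlyIncreasing I → StrictlyIncreasing J →
    Indep M (vecSet I) → Indep M (vecSet J) →
    (σ : Permutation′ ℓ) →
    ((¬ (Field._≈_ F (iteratedResidue F M χ (listing I σ) (vecSet J)) (Field.0# F)))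
       ⇔ ∃!Perm (λ τ → SameFlag M (listing J τ) (listing I σ)))
    × (∀ (τ : Permutation′ ℓ) →
         SameFlag M (listing J τ) (listing I σ) →
         (∀ (τ′ : Permutation′ ℓ) → SameFlag M (listing J τ′) (listing I σ) →
            ∀ (i : Fin ℓ) → τ′ ⟨$⟩ʳ i ≡ τ ⟨$⟩ʳ i) →
         Field._≈_ F (iteratedResidue F M χ (listing I σ) (vecSet J))
           (Field._*_ F (χo F χ (listing I σ))
              (Field._⁻¹ F (χo F χ (listing J τ)))))
    × (∀ (σ′ : Permutation′ ℓ) →
         Field._≈_ F (iteratedResidue F M χ (listing I σ′) (vecSet I)) (Field.1# F))
proposition2p8 F β M χ isM χ-algebra I J I↑ J↑ indI indJ σ =
  mk⇔ (λ ≉0 → let τ , flag = listingResidue≉0⇒flag ≉0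
               in τ , flag , λ τ′ flag′ → listing-flag-unique τ τ′ flag flag′)
      (λ (τ , flag , _) → listingResidue-flag≉0 τ flag) ,
  (λ τ flag _ → listingResidue-flag τ flag) ,
  listingResidue-self I I↑ indI
  where
    -- Only half of (UC1), χ ≉ 0 on independent sets, is needed.
    open OrderedSetResidues F isM χ (λ X → proj₂ (IsChiAlgebra.UC1 χ-algebra X))
    open FlagResidues I J I↑ J↑ indI indJ σ
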